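{- Let $f\ge 2$ and let $A_{i,j}$ ($i,j\in\{1,\ldots,f\}$, $i\neq j$) be a linked system of symmetric group divisible designs with parameters $(v,k,m,n,\lambda_1,\lambda_2)$, $v=mn$, such that $A_{i,j}(I_m\otimes J_n)=(I_m\otimes J_n)A_{i,j}=\frac{k}{m}J_v$ for all distinct $i,j$. Define $fv\times fv$ matrices $A_0=I_{fv}$, $A_1=I_{fm}\otimes(J_n-I_n)$, $A_2$ the block matrix whose $(i,j)$ block ($v\times v$) is $A_{i,j}$ for $i\neq j$ and $O_v$ for $i=j$, $A_3=(J_f-I_f)\otimes J_v-A_2$, and $A_4=I_f\otimes J_{mn}-I_{fm}\otimes J_n$. Then $\{A_0,A_1,A_2,A_3,A_4\}$ is a $4$-class symmetric association scheme; it is imprimitive with respect to $\mathcal{I}=\{0,1,4\}$ (i.e. $A_0+A_1+A_4=I_f\otimes J_{mn}$ is the adjacency matrix of an equivalence relation whose classes, the fibers, are the $f$ sets of size $mn$), it is uniform, and the restriction of the scheme to each equivalence class is a $2$-class imprimitive association scheme.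
   Context: $I_n,J_n,O_n$ denote the identity, all-ones and zero matrices of order $n$; $\otimes$ is the Kronecker product. A $v\times v$ $(0,1)$-matrix $A$ ($v=mn$, $m,n\ge2$, $0<k<v$) is the incidence matrix of a symmetric group divisible design with parameters $(v,k,m,n,\lambda_1,\lambda_2)$ if $AA^\top=A^\top A=kI_v+\lambda_1(I_m\otimes J_n-I_v)+\lambda_2(J_v-I_m\otimes J_n)$. A linked system of such designs is a family of $v\times v$ $(0,1)$-matrices $A_{i,j}$ ($i\ne j$ in $\{1,\ldots,f\}$) with $A_{i,j}^\top=A_{j,i}$, each an incidence matrix of such a design, such that there are integers $\sigma,\tau$ with $A_{i,j}A_{j,l}=\sigma A_{i,l}+\tau(J_v-A_{i,l})$ for all pairwise distinct $i,j,l$ (vacuous if $f=2$). A $d$-class symmetric association scheme on a finite set $X$ is a set of nonzero symmetric $(0,1)$-matrices $A_0,\ldots,A_d$ indexed by $X$ with $A_0=I$, $\sum_i A_i=J$, and $A_iA_j=\sum_k p_{i,j}^kA_k$ for nonnegative integers $p_{i,j}^k$. It is imprimitive if some $A_i$ ($i\neq0$) is the adjacency matrix of a disconnected graph; for an index set $\mathcal{I}\ni 0$ with $\sum_{j\in\mathcal{I}}A_j=I_p\otimes J_q$ ($p>1$) the $p$ blocks of size $q$ are the fibers. For fibers $U,V$, $\mathcal{I}(U,V)$ is the set of $i$ such that $A_i$ has a $1$ in some entry with row in $U$ and column in $V$, and $A_i^{UV}$ is $A_i$ with all entries outside $U\times V$ set to $0$. The scheme is uniform if the quotient scheme on fibers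 has one class and there are nonnegative integers $a_{i,j}^k$ such that $A_i^{UV}A_j^{VW}=\sum_k a_{i,j}^kA_k^{UW}$ for all fibers $U,V,W$ and $i\in\mathcal{I}(U,V)$, $j\in\mathcal{I}(V,W)$. -}

module Defs where

open import Data.Nat as ℕ using (ℕ; zero; suc; _≤_; _<_)
open import Data.Nat.Properties using (*-assoc)
open import Data.Integer as ℤ using (ℤ; +_; _+_; _-_; _*_)
open import Data.Fin as Fin using (Fin; zero; suc; remQuot; combine; cast; _≟_)
open import Data.Product using (Σ; ∃; ∃-syntax; _×_; _,_; proj₁; proj₂)
open import Data.Sum using (_⊎_)
open import Data.Bool using (Bool; true; false; if_then_else_)
open import Relation.Nullary using (¬_)
open import Relation.Nullary.Decidable using (⌊_⌋)
open import Relation.Binary.PropositionalEquality using (_≡_; _≢_; sym)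

Mat : ℕ → ℕ → Set
Mat r c = Fin r → Fin c → ℤ

∑ : ∀ n → (Fin n → ℤ) → ℤ
∑ zero    g = + 0
∑ (suc n) g = g zero + ∑ n (λ i → g (suc i))

infix 4 _≐_
_≐_ : ∀ {r c} → Mat r c → Mat r c → Set
A ≐ B = ∀ x y → A x y ≡ B x y

I : ∀ n → Mat n n
I n x y = if ⌊ x ≟ y ⌋ then + 1 else + 0

J : ∀ r c → Mat r c
J r c x y = + 1

O : ∀ r c → Mat r c
O r c x y = + 0

infixl 6 _⊕_ _⊖_
_⊕_ : ∀ {r c} → Mat r c → Mat r c → Mat r c
(A ⊕ B) x y = A x y + B x y

_⊖_ : ∀ {r c} → Mat r c → Mat r c → Mat r c
(A ⊖ B) x y = A x y - B x y

infixl 7 _·_ _⊙_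
_⊙_ : ∀ {r c} → ℤ → Mat r c → Mat r c
(s ⊙ A) x y = s * A x y

_·_ : ∀ {r s c} → Mat r s → Mat s c → Mat r c
_·_ {s = s} A B x y = ∑ s (λ z → A x z * B z y)

_ᵀ : ∀ {r c} → Mat r c → Mat c r
(A ᵀ) x y = A y x

-- Kronecker product; row index x of Fin (p * r) corresponds to the pair
-- (remQuot r x) in Fin p × Fin r (inverse of Data.Fin.combine).
infixl 8 _⊗_
_⊗_ : ∀ {p q r s} → Mat p q → Mat r s → Mat (p ℕ.* r) (q ℕ.* s)
_⊗_ {p} {q} {r} {s} A B x y =
  A (proj₁ (remQuot {p} r x)) (proj₁ (remQuot {q} s y))
  * B (proj₂ (remQuot {p} r x)) (proj₂ (remQuot {q} s y))

reassoc : ∀ a b c → Mat ((a ℕ.* b) ℕ.* c) ((a ℕ.* b) ℕ.* c)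
                  → Mat (a ℕ.* (b ℕ.* c)) (a ℕ.* (b ℕ.* c))
reassoc a b c M x y = M (cast (sym (*-assoc a b c)) x) (cast (sym (*-assoc a b c)) y)

ZeroOne : ∀ {r c} → Mat r c → Set
ZeroOne A = ∀ x y → (A x y ≡ + 0) ⊎ (A x y ≡ + 1)

IsSGDD : (k m n λ₁ λ₂ : ℕ) → Mat (m ℕ.* n) (m ℕ.* n) → Set
IsSGDD k m n λ₁ λ₂ A =
  2 ≤ m × 2 ≤ n × 0 < k × k < m ℕ.* n × ZeroOne A
  × (A · A ᵀ ≐ G) × (A ᵀ · A ≐ G)
  where
    v = m ℕ.* n
    G : Mat v v
    G = (+ k ⊙ I v) ⊕ (+ λ₁ ⊙ ((I m ⊗ J n n) ⊖ I v))
        ⊕ (+ λ₂ ⊙ (J v v ⊖ (I m ⊗ J n n)))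

-- linked system: A i j is only meaningful for i ≢ j
IsLinkedSystem : (f k m n λ₁ λ₂ : ℕ)
  → (Fin f → Fin f → Mat (m ℕ.* n) (m ℕ.* n)) → Set
IsLinkedSystem f k m n λ₁ λ₂ A =
  (∀ i j → i ≢ j → A j i ≐ A i j ᵀ)
  × (∀ i j → i ≢ j → IsSGDD k m n λ₁ λ₂ (A i j))
  × Σ ℤ λ σ → Σ ℤ λ τ → (∀ i j l → i ≢ j → j ≢ l → i ≢ l →
       A i j · A j l ≐ (σ ⊙ A i l) ⊕ (τ ⊙ (J v v ⊖ A i l)))
  where v = m ℕ.* n

NonZeroMat : ∀ {r c} → Mat r c → Set
NonZeroMat {r} {c} A = Σ (Fin r) λ x → Σ (Fin c) λ y → (A x y ≢ + 0)

∑M : ∀ {r c} d → (Fin d → Mat r c) → Mat r c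
∑M d A x y = ∑ d (λ i → A i x y)

IsSymAssocScheme : ∀ {N} d → (Fin (suc d) → Mat N N) → Set
IsSymAssocScheme {N} d A =
  (A zero ≐ I N)
  × (∀ i → ZeroOne (A i))
  × (∀ i → A i ᵀ ≐ A i)
  × (∀ i → NonZeroMat (A i))
  × (∑M (suc d) A ≐ J N N)
  × (∀ i j → Σ (Fin (suc d) → ℕ) λ p → (A i · A j ≐ ∑M (suc d) (λ k → (+ (p k)) ⊙ A k)))

Disconnected : ∀ {N} → Mat N N → Set
Disconnected {N} B =
  Σ (Fin N → Bool) λ S → ((∃[ x ] (S x ≡ true)) × (∃[ y ] (S y ≡ false))
         × (∀ x y → S x ≡ true → S y ≡ false → B x y ≡ + 0))

IsImprimitive : ∀ {N} d → (Fin (suc d) → Mat N N) → Set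
IsImprimitive d A = ∃[ i ] ((i ≢ zero) × Disconnected (A i))

-- Fibers and uniformity, for a scheme on Fin (p * q) with fibers
-- the p blocks of size q (i.e. blocks of I p ⊗ J q)

fiber : ∀ {p} q → Fin (p ℕ.* q) → Fin p
fiber {p} q x = proj₁ (remQuot {p} q x)

InI : ∀ {p q d} → (Fin (suc d) → Mat (p ℕ.* q) (p ℕ.* q))
      → Fin p → Fin p → Fin (suc d) → Set
InI {q = q} A U V i =
  ∃[ x ] ∃[ y ] (fiber q x ≡ U × fiber q y ≡ V × A i x y ≡ + 1)

restrictUV : ∀ {p q} → Mat (p ℕ.* q) (p ℕ.* q) → Fin p → Fin p
             → Mat (p ℕ.* q) (p ℕ.* q)
restrictUV {q = q} M U V x y =
  if ⌊ fiber q x ≟ U ⌋ then (if ⌊ fiber q y ≟ V ⌋ then M x y else + 0) else + 0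

IsUniform : ∀ {p q} d → (Fin (suc d) → Mat (p ℕ.* q) (p ℕ.* q)) → Set
IsUniform {p} {q} d A =
  -- quotient scheme on fibers has one class: all pairs of distinct
  -- fibers U ≠ V have the same set 𝓘(U,V)
  (∀ U V U′ V′ → U ≢ V → U′ ≢ V′ → ∀ i →
     (InI {p} {q} A U V i → InI {p} {q} A U′ V′ i)
     × (InI {p} {q} A U′ V′ i → InI {p} {q} A U V i))
  × Σ (Fin (suc d) → Fin (suc d) → Fin (suc d) → ℕ) λ a → (∀ U V W i j → InI {p} {q} A U V i → InI {p} {q} A V W j →
       restrictUV (A i) U V · restrictUV (A j) V W
         ≐ ∑M (suc d) (λ k → (+ (a i j k)) ⊙ restrictUV (A k) U W))

restrictFiber : ∀ {p q} → Mat (p ℕ.* q) (p ℕ.* q) → Fin p → Mat q q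
restrictFiber M U a b = M (combine U a) (combine U b)

module Construction (f m n : ℕ)
         (A : Fin f → Fin f → Mat (m ℕ.* n) (m ℕ.* n)) where

  v : ℕ
  v = m ℕ.* n

  N : ℕ
  N = f ℕ.* v

  A₀ : Mat N N
  A₀ = I N

  A₁ : Mat N N
  A₁ = reassoc f m n (I (f ℕ.* m) ⊗ (J n n ⊖ I n))

  A₂ : Mat N N
  A₂ x y =
    let i = proj₁ (remQuot {f} v x) ; a = proj₂ (remQuot {f} v x)
        j = proj₁ (remQuot {f} v y) ; b = proj₂ (remQuot {f} v y)
    in if ⌊ i ≟ j ⌋ then O v v a b else A i j a b

  A₃ : Mat N N
  A₃ = ((J f f ⊖ I f) ⊗ J v v) ⊖ A₂

  A₄ : Mat N N
  A₄ = (I f ⊗ J v v) ⊖ reassoc f m n (I (f ℕ.* m) ⊗ J n n)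

  scheme : Fin 5 → Mat N N
  scheme zero = A₀
  scheme (suc zero) = A₁
  scheme (suc (suc zero)) = A₂
  scheme (suc (suc (suc zero))) = A₃
  scheme (suc (suc (suc (suc zero)))) = A₄

  𝓘 : Fin 3 → Fin 5
  𝓘 zero = zero
  𝓘 (suc zero) = suc zero
  𝓘 (suc (suc zero)) = suc (suc (suc (suc zero)))

  -- the restriction of the scheme to the fiber U (the classes A_0, A_1, A_4,
  -- the only ones that are nonzero on U × U)
  restricted : Fin f → Fin 3 → Mat v v
  restricted U i = restrictFiber {f} {v} (scheme (𝓘 i)) U

-- The N = f·v points are pairs (fibre U, point a of Fin v), and every class of the
-- scheme is block-structured: its (U,V) block vanishes unless U = V (classes 0, 1, 4),
-- resp. U ≠ V (classes 2, 3), and otherwise it is I, G − I, A_UV, J − A_UV or J − G,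
-- where G = I_m ⊗ J_n.  These generators multiply like a small algebra: G² = nG,
-- GJ = JG = nJ, GA = AG = (k/m)J, AJ = JA = kJ, A_UV A_VU is the Gram matrix
-- kI + λ₁(G − I) + λ₂(J − G) of the design and A_UV A_VW = σA_UW + τ(J − A_UW).
-- Hence the product of a class block of (U,V) with one of (V,W) is a fixed integer
-- combination of the class blocks of (U,W).  Its coefficients are nonnegative, being
-- entries of a product of 0/1 matrices at a pair that lies in a single class; they are
-- the uniformity constants, restricting to a fibre keeps exactly the classes 0, 1, 4,
-- and summing over the middle fibre multiplies them by the number of admissible middle
-- fibres, which gives the intersection numbers.

module Submission where

open import Defs
open import Data.Nat as ℕ using (ℕ; zero; suc; _≤_; _<_; s≤s; z≤n; _∸_)
import Data.Nat.Properties as ℕₚ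
import Data.Nat.Tactic.RingSolver as ℕ-Ring
open import Data.Integer as ℤ using (ℤ; +_; _+_; _-_; _*_; -_; _≥_; +≤+; ∣_∣)
import Data.Integer.Properties as ℤₚ
open import Data.Integer.Tactic.RingSolver using (solve-∀)
open import Algebra.Properties.Semiring.Sum ℤₚ.+-*-semiring using (sum; *-distribˡ-sum)
open import Data.Fin as Fin using (Fin; zero; suc; remQuot; combine; cast; _≟_; quotient; remainder; toℕ)
import Data.Fin.Properties as Finₚ
open import Data.Unit using (⊤; tt)
open import Data.Vec.Functional using ([]; _∷_)
open import Data.Fin.Patterns using (0F; 1F; 2F; 3F; 4F)
open import Data.Product using (Σ; ∃; ∃-syntax; _×_; _,_; proj₁; proj₂)
open import Data.Sum using (_⊎_; inj₁; inj₂)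
open import Data.Bool using (Bool; true; false; if_then_else_)
open import Data.Empty using (⊥-elim)
open import Relation.Nullary using (¬_; Dec; yes; no)
open import Relation.Nullary.Decidable using (⌊_⌋; ¬?)
open import Function using (_∘_)
open import Relation.Binary.PropositionalEquality
  using (_≡_; _≢_; refl; sym; trans; cong; cong₂; subst; subst₂; module ≡-Reasoning)

∑≡sum : ∀ n (g : Fin n → ℤ) → ∑ n g ≡ sum g
∑≡sum zero    g = refl
∑≡sum (suc n) g = cong (_+_ (g zero)) (∑≡sum n (λ i → g (suc i)))

∑-cong : ∀ n {g h : Fin n → ℤ} → (∀ i → g i ≡ h i) → ∑ n g ≡ ∑ n h
∑-cong zero    eq = refl
∑-cong (suc n) eq = cong₂ _+_ (eq zero) (∑-cong n (λ i → eq (suc i)))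

∑-*ˡ : ∀ n c (g : Fin n → ℤ) → ∑ n (λ i → c * g i) ≡ c * ∑ n g
∑-*ˡ n c g = begin
  ∑ n (λ i → c * g i)   ≡⟨ ∑≡sum n _ ⟩
  sum (λ i → c * g i)   ≡⟨ sym (*-distribˡ-sum c g) ⟩
  c * sum g             ≡⟨ cong (c *_) (sym (∑≡sum n g)) ⟩
  c * ∑ n g             ∎
  where open ≡-Reasoning

∑-*ʳ : ∀ n c (g : Fin n → ℤ) → ∑ n (λ i → g i * c) ≡ ∑ n g * c
∑-*ʳ n c g = begin
  ∑ n (λ i → g i * c)   ≡⟨ ∑-cong n (λ i → ℤₚ.*-comm (g i) c) ⟩
  ∑ n (λ i → c * g i)   ≡⟨ ∑-*ˡ n c g ⟩
  c * ∑ n g             ≡⟨ ℤₚ.*-comm c (∑ n g) ⟩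
  ∑ n g * c             ∎
  where open ≡-Reasoning

∑-minus : ∀ n (g h : Fin n → ℤ) → ∑ n (λ i → g i - h i) ≡ ∑ n g - ∑ n h
∑-minus zero    g h = refl
∑-minus (suc n) g h = trans (cong (_+_ (g zero - h zero)) (∑-minus n (λ i → g (suc i)) (λ i → h (suc i))))
                        (interchange (g zero) (h zero) _ _)
  where
  interchange : ∀ a b c d → a - b + (c - d) ≡ a + c - (b + d)
  interchange = solve-∀

∑-const : ∀ n c → ∑ n (λ _ → c) ≡ + n * c
∑-const zero    c = sym (ℤₚ.*-zeroˡ c)
∑-const (suc n) c = begin
  c + ∑ n (λ _ → c)   ≡⟨ cong (_+_ c) (∑-const n c) ⟩
  c + + n * c         ≡⟨ sym (ℤₚ.suc-* (+ n) c) ⟩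
  + suc n * c         ∎
  where open ≡-Reasoning

∑-zero : ∀ n → ∑ n (λ _ → + 0) ≡ + 0
∑-zero n = trans (∑-const n (+ 0)) (ℤₚ.*-zeroʳ (+ n))

∑-vanishing : ∀ n (g : Fin n → ℤ) → (∀ i → g i ≡ + 0) → ∑ n g ≡ + 0
∑-vanishing n g g≡0 = trans (∑-cong n g≡0) (∑-zero n)

∑-nonneg : ∀ n (g : Fin n → ℤ) → (∀ i → g i ≥ + 0) → ∑ n g ≥ + 0
∑-nonneg zero    g g≥0 = +≤+ z≤n
∑-nonneg (suc n) g g≥0 = ℤₚ.+-mono-≤ (g≥0 zero) (∑-nonneg n (λ i → g (suc i)) (λ i → g≥0 (suc i)))

∑-++ : ∀ p q (g : Fin (p ℕ.+ q) → ℤ) →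
       ∑ (p ℕ.+ q) g ≡ ∑ p (λ i → g (i Fin.↑ˡ q)) + ∑ q (λ j → g (p Fin.↑ʳ j))
∑-++ zero    q g = sym (ℤₚ.+-identityˡ _)
∑-++ (suc p) q g = trans (cong (_+_ (g zero)) (∑-++ p q (λ i → g (suc i))))
                         (sym (ℤₚ.+-assoc (g zero) _ _))

∑-combine : ∀ p q (g : Fin (p ℕ.* q) → ℤ) → ∑ (p ℕ.* q) g ≡ ∑ p (λ i → ∑ q (λ j → g (combine i j)))
∑-combine zero    q g = refl
∑-combine (suc p) q g = trans (∑-++ q (p ℕ.* q) g)
                              (cong (_+_ (∑ q (λ j → g (j Fin.↑ˡ p ℕ.* q)))) (∑-combine p q (λ i → g (q Fin.↑ʳ i))))

I-≡ : ∀ {n} {i j : Fin n} → i ≡ j → I n i j ≡ + 1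
I-≡ {i = i} {j} i≡j with i ≟ j
... | yes _   = refl
... | no  i≢j = ⊥-elim (i≢j i≡j)

I-≢ : ∀ {n} {i j : Fin n} → i ≢ j → I n i j ≡ + 0
I-≢ {i = i} {j} i≢j with i ≟ j
... | yes i≡j = ⊥-elim (i≢j i≡j)
... | no  _   = refl

I-sym : ∀ {n} (i j : Fin n) → I n i j ≡ I n j i
I-sym i j with i ≟ j | j ≟ i
... | yes _   | yes _   = refl
... | no  _   | no  _   = refl
... | yes i≡j | no  j≢i = ⊥-elim (j≢i (sym i≡j))
... | no  i≢j | yes j≡i = ⊥-elim (i≢j (sym j≡i))

∑-δˡ : ∀ n (i : Fin n) (g : Fin n → ℤ) → ∑ n (λ j → I n i j * g j) ≡ g i
∑-δˡ (suc n) zero    g = begin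
  + 1 * g zero + ∑ n (λ j → + 0 * g (suc j))   ≡⟨ cong₂ _+_ (ℤₚ.*-identityˡ (g zero)) (∑-cong n (λ j → ℤₚ.*-zeroˡ (g (suc j)))) ⟩
  g zero + ∑ n (λ _ → + 0)                     ≡⟨ cong (_+_ (g zero)) (∑-zero n) ⟩
  g zero + + 0                                 ≡⟨ ℤₚ.+-identityʳ (g zero) ⟩
  g zero                                       ∎
  where open ≡-Reasoning
∑-δˡ (suc n) (suc i) g = begin
  I (suc n) (suc i) zero * g zero + ∑ n (λ j → I (suc n) (suc i) (suc j) * g (suc j))
    ≡⟨ cong₂ _+_ (ℤₚ.*-zeroˡ (g zero)) (∑-cong n (λ j → cong (_* g (suc j)) (I-suc i j))) ⟩
  + 0 + ∑ n (λ j → I n i j * g (suc j))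
    ≡⟨ ℤₚ.+-identityˡ _ ⟩
  ∑ n (λ j → I n i j * g (suc j))
    ≡⟨ ∑-δˡ n i (λ j → g (suc j)) ⟩
  g (suc i) ∎
  where
  open ≡-Reasoning
  I-suc : ∀ {n} (i j : Fin n) → I (suc n) (suc i) (suc j) ≡ I n i j
  I-suc i j with i ≟ j
  ... | yes _ = refl
  ... | no  _ = refl

∑-δʳ : ∀ n (i : Fin n) (g : Fin n → ℤ) → ∑ n (λ j → g j * I n j i) ≡ g i
∑-δʳ n i g = trans (∑-cong n (λ j → trans (ℤₚ.*-comm (g j) _) (cong (_* g j) (I-sym j i)))) (∑-δˡ n i g)

∑-δᶜ : ∀ p (U : Fin p) (h : Fin p → ℤ) → ∑ p (λ V → (+ 1 - I p U V) * h V) ≡ ∑ p h - h U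
∑-δᶜ p U h = begin
  ∑ p (λ V → (+ 1 - I p U V) * h V)       ≡⟨ ∑-cong p (λ V → distrib (I p U V) (h V)) ⟩
  ∑ p (λ V → h V - I p U V * h V)         ≡⟨ ∑-minus p h _ ⟩
  ∑ p h - ∑ p (λ V → I p U V * h V)       ≡⟨ cong (_-_ (∑ p h)) (∑-δˡ p U h) ⟩
  ∑ p h - h U                             ∎
  where
  open ≡-Reasoning
  distrib : ∀ d x → (+ 1 - d) * x ≡ x - d * x
  distrib = solve-∀

∑-column-I : ∀ p (W : Fin p) → ∑ p (λ V → I p V W) ≡ + 1
∑-column-I p W = trans (∑-cong p (λ V → sym (ℤₚ.*-identityˡ (I p V W)))) (∑-δʳ p W (λ _ → + 1))

∑-column-Iᶜ : ∀ p (W : Fin p) → ∑ p (λ V → + 1 - I p V W) ≡ + p - + 1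
∑-column-Iᶜ p W = begin
  ∑ p (λ V → + 1 - I p V W)               ≡⟨ ∑-minus p (λ _ → + 1) _ ⟩
  ∑ p (λ _ → + 1) - ∑ p (λ V → I p V W)   ≡⟨ cong₂ _-_ (trans (∑-const p (+ 1)) (ℤₚ.*-identityʳ (+ p))) (∑-column-I p W) ⟩
  + p - + 1                               ∎
  where open ≡-Reasoning

Bit : ℤ → Set
Bit x = x ≡ + 0 ⊎ x ≡ + 1

I-bit : ∀ {n} (i j : Fin n) → Bit (I n i j)
I-bit i j with i ≟ j
... | yes _ = inj₂ refl
... | no  _ = inj₁ refl

Bit-* : ∀ {x y} → Bit x → Bit y → Bit (x * y)
Bit-* (inj₁ refl) _           = inj₁ refl
Bit-* (inj₂ refl) (inj₁ refl) = inj₁ refl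
Bit-* (inj₂ refl) (inj₂ refl) = inj₂ refl

Bit-complement : ∀ {x} → Bit x → Bit (+ 1 - x)
Bit-complement (inj₁ refl) = inj₂ refl
Bit-complement (inj₂ refl) = inj₁ refl

Bit-nonneg : ∀ {x} → Bit x → x ≥ + 0
Bit-nonneg (inj₁ refl) = +≤+ z≤n
Bit-nonneg (inj₂ refl) = +≤+ z≤n

∑-bits-nonzero : ∀ n (g : Fin n → ℤ) → (∀ i → Bit (g i)) → ∑ n g ≢ + 0 → ∃ λ i → g i ≡ + 1
∑-bits-nonzero zero    g bits ∑≢0 = ⊥-elim (∑≢0 refl)
∑-bits-nonzero (suc n) g bits ∑≢0 with bits zero
... | inj₂ g₀≡1 = zero , g₀≡1
... | inj₁ g₀≡0 with ∑-bits-nonzero n (λ i → g (suc i)) (λ i → bits (suc i))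
                       (λ ∑≡0 → ∑≢0 (cong₂ _+_ g₀≡0 ∑≡0))
...   | i , gᵢ≡1 = suc i , gᵢ≡1

∑-bits-short : ∀ n (g : Fin n → ℤ) → (∀ i → Bit (g i)) → ∑ n g ≢ + n → ∃ λ i → g i ≡ + 0
∑-bits-short zero    g bits ∑≢n = ⊥-elim (∑≢n refl)
∑-bits-short (suc n) g bits ∑≢n with bits zero
... | inj₁ g₀≡0 = zero , g₀≡0
... | inj₂ g₀≡1 with ∑-bits-short n (λ i → g (suc i)) (λ i → bits (suc i))
                       (λ ∑≡n → ∑≢n (trans (cong₂ _+_ g₀≡1 ∑≡n) (sym (ℤₚ.pos-+ 1 n))))
...   | i , gᵢ≡0 = suc i , gᵢ≡0

if-≟-then : ∀ {n} (i j : Fin n) x → (if ⌊ i ≟ j ⌋ then x else + 0) ≡ I n i j * x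
if-≟-then i j x with i ≟ j
... | yes _ = sym (ℤₚ.*-identityˡ x)
... | no  _ = sym (ℤₚ.*-zeroˡ x)

if-≟-else : ∀ {n} (i j : Fin n) x → (if ⌊ i ≟ j ⌋ then + 0 else x) ≡ (+ 1 - I n i j) * x
if-≟-else i j x with i ≟ j
... | yes _ = sym (ℤₚ.*-zeroˡ x)
... | no  _ = sym (ℤₚ.*-identityˡ x)

·-cong : ∀ {r s c} {P P′ : Mat r s} {Q Q′ : Mat s c} → P ≐ P′ → Q ≐ Q′ → P · Q ≐ P′ · Q′
·-cong {s = s} P≐P′ Q≐Q′ x y = ∑-cong s (λ z → cong₂ _*_ (P≐P′ x z) (Q≐Q′ z y))

·-identityˡ : ∀ {r c} (X : Mat r c) → I r · X ≐ X
·-identityˡ {r} X x y = ∑-δˡ r x (λ z → X z y)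

·-identityʳ : ∀ {r c} (X : Mat r c) → X · I c ≐ X
·-identityʳ {c = c} X x y = ∑-δʳ c y (X x)

·-zeroˡ : ∀ {r s c} (X : Mat s c) → O r s · X ≐ O r c
·-zeroˡ {s = s} X x y = trans (∑-cong s (λ z → ℤₚ.*-zeroˡ (X z y))) (∑-zero s)

·-zeroʳ : ∀ {r s c} (X : Mat r s) → X · O s c ≐ O r c
·-zeroʳ {s = s} X x y = trans (∑-cong s (λ z → ℤₚ.*-zeroʳ (X x z))) (∑-zero s)

·-distribʳ-⊖ : ∀ {r s c} (P Q : Mat r s) (R : Mat s c) → (P ⊖ Q) · R ≐ (P · R) ⊖ (Q · R)
·-distribʳ-⊖ {s = s} P Q R x y =
  trans (∑-cong s (λ z → distrib (P x z) (Q x z) (R z y))) (∑-minus s _ _)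
  where
  distrib : ∀ p q r → (p - q) * r ≡ p * r - q * r
  distrib = solve-∀

·-distribˡ-⊖ : ∀ {r s c} (P : Mat r s) (Q R : Mat s c) → P · (Q ⊖ R) ≐ (P · Q) ⊖ (P · R)
·-distribˡ-⊖ {s = s} P Q R x y =
  trans (∑-cong s (λ z → distrib (P x z) (Q z y) (R z y))) (∑-minus s _ _)
  where
  distrib : ∀ p q r → p * (q - r) ≡ p * q - p * r
  distrib = solve-∀

⊗-combine : ∀ {p q r s} (P : Mat p q) (Q : Mat r s) i j i′ j′ →
            (P ⊗ Q) (combine i j) (combine i′ j′) ≡ P i i′ * Q j j′
⊗-combine {p} {q} {r} {s} P Q i j i′ j′ =
  cong₂ (λ x y → P (proj₁ x) (proj₁ y) * Q (proj₂ x) (proj₂ y))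
        (Finₚ.remQuot-combine {p} {r} i j) (Finₚ.remQuot-combine {q} {s} i′ j′)

I-combine : ∀ p q (i i′ : Fin p) (j j′ : Fin q) →
            I (p ℕ.* q) (combine i j) (combine i′ j′) ≡ I p i i′ * I q j j′
I-combine p q i i′ j j′ with i ≟ i′ | j ≟ j′
... | yes refl | yes refl = I-≡ refl
... | yes refl | no j≢j′  = I-≢ (j≢j′ ∘ Finₚ.combine-injectiveʳ i j i j′)
... | no i≢i′  | _        = I-≢ (i≢i′ ∘ Finₚ.combine-injectiveˡ i j i′ j′)

elim-combine₂ : ∀ {p q r s} (P : Fin (p ℕ.* q) → Fin (r ℕ.* s) → Set) →
                (∀ (i : Fin p) (j : Fin q) (i′ : Fin r) (j′ : Fin s) → P (combine i j) (combine i′ j′)) →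
                ∀ x y → P x y
elim-combine₂ {p} {q} {r} {s} P h x y =
  subst₂ P (Finₚ.combine-remQuot {p} q x) (Finₚ.combine-remQuot {r} s y) (h _ _ _ _)

cast-assoc-combine : ∀ a b c (i : Fin a) (j : Fin b) (k : Fin c) →
                     cast (sym (ℕₚ.*-assoc a b c)) (combine i (combine j k)) ≡ combine (combine i j) k
cast-assoc-combine a b c i j k = Finₚ.toℕ-injective (begin
  toℕ (cast _ (combine i (combine j k)))        ≡⟨ Finₚ.toℕ-cast _ (combine i (combine j k)) ⟩
  toℕ (combine i (combine j k))                 ≡⟨ Finₚ.toℕ-combine i (combine j k) ⟩
  b ℕ.* c ℕ.* toℕ i ℕ.+ toℕ (combine j k)       ≡⟨ cong (b ℕ.* c ℕ.* toℕ i ℕ.+_) (Finₚ.toℕ-combine j k) ⟩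
  b ℕ.* c ℕ.* toℕ i ℕ.+ (c ℕ.* toℕ j ℕ.+ toℕ k) ≡⟨ horner b c (toℕ i) (toℕ j) (toℕ k) ⟩
  c ℕ.* (b ℕ.* toℕ i ℕ.+ toℕ j) ℕ.+ toℕ k       ≡⟨ cong (λ z → c ℕ.* z ℕ.+ toℕ k) (sym (Finₚ.toℕ-combine i j)) ⟩
  c ℕ.* toℕ (combine i j) ℕ.+ toℕ k             ≡⟨ sym (Finₚ.toℕ-combine (combine i j) k) ⟩
  toℕ (combine (combine i j) k)                 ∎)
  where
  open ≡-Reasoning
  horner : ∀ b c x y z → b ℕ.* c ℕ.* x ℕ.+ (c ℕ.* y ℕ.+ z) ≡ c ℕ.* (b ℕ.* x ℕ.+ y) ℕ.+ z
  horner = ℕ-Ring.solve-∀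

quotient-combine : ∀ {p q} (i : Fin p) (j : Fin q) → quotient q (combine i j) ≡ i
quotient-combine i j = cong proj₁ (Finₚ.remQuot-combine i j)

+1≢+0 : + 1 ≢ + 0
+1≢+0 ()

distinct-pair : ∀ {p} → 2 ≤ p → Σ (Fin p) λ i → Σ (Fin p) λ j → i ≢ j
distinct-pair (s≤s (s≤s _)) = zero , suc zero , λ ()

⌊≟⌋-true : ∀ {n} {i j : Fin n} → i ≡ j → ⌊ i ≟ j ⌋ ≡ true
⌊≟⌋-true {i = i} {j} i≡j with i ≟ j
... | yes _   = refl
... | no  i≢j = ⊥-elim (i≢j i≡j)

⌊≟⌋-false : ∀ {n} {i j : Fin n} → i ≢ j → ⌊ i ≟ j ⌋ ≡ false
⌊≟⌋-false {i = i} {j} i≢j with i ≟ j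
... | yes i≡j = ⊥-elim (i≢j i≡j)
... | no  _   = refl

⌊≟⌋-separates : ∀ {n} {i i′ j : Fin n} → ⌊ i ≟ j ⌋ ≡ true → ⌊ i′ ≟ j ⌋ ≡ false → i ≢ i′
⌊≟⌋-separates i-in i′-out refl with trans (sym i-in) i′-out
... | ()

disconnected-by-blocks : ∀ {p q} (B : Mat (p ℕ.* q) (p ℕ.* q)) → 2 ≤ p → Fin q →
  (∀ i a i′ a′ → i ≢ i′ → B (combine i a) (combine i′ a′) ≡ + 0) → Disconnected B
disconnected-by-blocks {p} {q} B 2≤p a₀ B-between =
  S , (combine i₀ a₀ , ⌊≟⌋-true (quotient-combine i₀ a₀))
    , (combine i₁ a₀ , ⌊≟⌋-false (λ i₁≡i₀ → i₀≢i₁ (sym (trans (sym (quotient-combine i₁ a₀)) i₁≡i₀))))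
    , elim-combine₂ (λ x y → S x ≡ true → S y ≡ false → B x y ≡ + 0) edges
  where
  i₀ i₁ : Fin p
  i₀ = proj₁ (distinct-pair 2≤p)
  i₁ = proj₁ (proj₂ (distinct-pair 2≤p))
  i₀≢i₁ : i₀ ≢ i₁
  i₀≢i₁ = proj₂ (proj₂ (distinct-pair 2≤p))
  S : Fin (p ℕ.* q) → Bool
  S x = ⌊ quotient q x ≟ i₀ ⌋
  edges : ∀ i a i′ a′ → S (combine i a) ≡ true → S (combine i′ a′) ≡ false → B (combine i a) (combine i′ a′) ≡ + 0
  edges i a i′ a′ inside outside = B-between i a i′ a′ λ i≡i′ →
    ⌊≟⌋-separates inside outside (trans (quotient-combine i a) (trans i≡i′ (sym (quotient-combine i′ a′))))

-- The group divisible structure of Fin (m * n)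

module GroupDivisible (m n : ℕ) where

  G : Mat (m ℕ.* n) (m ℕ.* n)
  G = I m ⊗ J n n

  group : Fin (m ℕ.* n) → Fin m
  group = quotient n

  Gram : ℕ → ℕ → ℕ → Mat (m ℕ.* n) (m ℕ.* n)
  Gram k λ₁ λ₂ = (+ k ⊙ I (m ℕ.* n)) ⊕ (+ λ₁ ⊙ (G ⊖ I (m ℕ.* n))) ⊕ (+ λ₂ ⊙ (J (m ℕ.* n) (m ℕ.* n) ⊖ G))

  G-entry : ∀ a b → G a b ≡ I m (group a) (group b)
  G-entry a b = ℤₚ.*-identityʳ _

  G-combine : ∀ β t β′ t′ → G (combine β t) (combine β′ t′) ≡ I m β β′
  G-combine β t β′ t′ = trans (G-entry _ _) (cong₂ (I m) (quotient-combine β t) (quotient-combine β′ t′))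

  G-minus-I : ∀ β t β′ t′ →
    G (combine β t) (combine β′ t′) - I (m ℕ.* n) (combine β t) (combine β′ t′) ≡ I m β β′ * (+ 1 - I n t t′)
  G-minus-I β t β′ t′ = begin
    G (combine β t) (combine β′ t′) - I (m ℕ.* n) (combine β t) (combine β′ t′)
      ≡⟨ cong₂ _-_ (G-combine β t β′ t′) (I-combine m n β β′ t t′) ⟩
    I m β β′ - I m β β′ * I n t t′
      ≡⟨ factor (I m β β′) (I n t t′) ⟩
    I m β β′ * (+ 1 - I n t t′) ∎
    where
    open ≡-Reasoning
    factor : ∀ x y → x - x * y ≡ x * (+ 1 - y)
    factor = solve-∀

  G-bit : ∀ a b → Bit (G a b)
  G-bit a b = subst Bit (sym (G-entry a b)) (I-bit (group a) (group b))

  G·-sum : ∀ {c} (X : Mat (m ℕ.* n) c) a y → (G · X) a y ≡ ∑ n (λ t → X (combine (group a) t) y)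
  G·-sum X a y = begin
    (G · X) a y
      ≡⟨ ∑-combine m n _ ⟩
    ∑ m (λ β → ∑ n (λ t → G a (combine β t) * X (combine β t) y))
      ≡⟨ ∑-cong m (λ β → ∑-cong n (λ t → cong (_* X (combine β t) y)
           (trans (G-entry a _) (cong (I m (group a)) (quotient-combine β t))))) ⟩
    ∑ m (λ β → ∑ n (λ t → I m (group a) β * X (combine β t) y))
      ≡⟨ ∑-cong m (λ β → ∑-*ˡ n (I m (group a) β) _) ⟩
    ∑ m (λ β → I m (group a) β * ∑ n (λ t → X (combine β t) y))
      ≡⟨ ∑-δˡ m (group a) _ ⟩
    ∑ n (λ t → X (combine (group a) t) y) ∎
    where open ≡-Reasoning

  ·G-sum : ∀ {r} (X : Mat r (m ℕ.* n)) x c → (X · G) x c ≡ ∑ n (λ t → X x (combine (group c) t))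
  ·G-sum X x c = begin
    (X · G) x c
      ≡⟨ ∑-combine m n _ ⟩
    ∑ m (λ β → ∑ n (λ t → X x (combine β t) * G (combine β t) c))
      ≡⟨ ∑-cong m (λ β → ∑-cong n (λ t → cong (X x (combine β t) *_)
           (trans (G-entry _ c) (cong (λ γ → I m γ (group c)) (quotient-combine β t))))) ⟩
    ∑ m (λ β → ∑ n (λ t → X x (combine β t) * I m β (group c)))
      ≡⟨ ∑-cong m (λ β → ∑-*ʳ n (I m β (group c)) _) ⟩
    ∑ m (λ β → ∑ n (λ t → X x (combine β t)) * I m β (group c))
      ≡⟨ ∑-δʳ m (group c) (λ β → ∑ n (λ t → X x (combine β t))) ⟩
    ∑ n (λ t → X x (combine (group c) t)) ∎
    where open ≡-Reasoning

  G·G : G · G ≐ + n ⊙ G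
  G·G a c = begin
    (G · G) a c                                          ≡⟨ G·-sum G a c ⟩
    ∑ n (λ t → G (combine (group a) t) c)               ≡⟨ ∑-cong n (λ t → trans (G-entry _ c)
                                                            (cong (λ γ → I m γ (group c)) (quotient-combine (group a) t))) ⟩
    ∑ n (λ _ → I m (group a) (group c))                 ≡⟨ ∑-const n _ ⟩
    + n * I m (group a) (group c)                       ≡⟨ cong (+ n *_) (sym (G-entry a c)) ⟩
    + n * G a c                                         ∎
    where open ≡-Reasoning

  G·J : G · J (m ℕ.* n) (m ℕ.* n) ≐ + n ⊙ J (m ℕ.* n) (m ℕ.* n)
  G·J a c = trans (G·-sum (J _ _) a c) (∑-const n (+ 1))

  J·G : J (m ℕ.* n) (m ℕ.* n) · G ≐ + n ⊙ J (m ℕ.* n) (m ℕ.* n)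
  J·G a c = trans (·G-sum (J _ _) a c) (∑-const n (+ 1))

  J·J : J (m ℕ.* n) (m ℕ.* n) · J (m ℕ.* n) (m ℕ.* n) ≐ + (m ℕ.* n) ⊙ J (m ℕ.* n) (m ℕ.* n)
  J·J a c = ∑-const (m ℕ.* n) (+ 1)

  J·-via-G : ∀ {c} (X : Mat (m ℕ.* n) c) (t : Fin n) a y →
             (J (m ℕ.* n) (m ℕ.* n) · X) a y ≡ ∑ m (λ β → (G · X) (combine β t) y)
  J·-via-G X t a y = begin
    ∑ (m ℕ.* n) (λ b → + 1 * X b y)                       ≡⟨ ∑-combine m n _ ⟩
    ∑ m (λ β → ∑ n (λ t′ → + 1 * X (combine β t′) y))     ≡⟨ ∑-cong m (λ β → ∑-cong n (λ t′ →
                                                              trans (ℤₚ.*-identityˡ _)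
                                                                (cong (λ γ → X (combine γ t′) y) (sym (quotient-combine β t))))) ⟩
    ∑ m (λ β → ∑ n (λ t′ → X (combine (group (combine β t)) t′) y))
                                                          ≡⟨ ∑-cong m (λ β → sym (G·-sum X (combine β t) y)) ⟩
    ∑ m (λ β → (G · X) (combine β t) y)                   ∎
    where open ≡-Reasoning

  ·J-via-G : ∀ {r} (X : Mat r (m ℕ.* n)) (t : Fin n) x c →
             (X · J (m ℕ.* n) (m ℕ.* n)) x c ≡ ∑ m (λ β → (X · G) x (combine β t))
  ·J-via-G X t x c = begin
    ∑ (m ℕ.* n) (λ b → X x b * + 1)                       ≡⟨ ∑-combine m n _ ⟩
    ∑ m (λ β → ∑ n (λ t′ → X x (combine β t′) * + 1))     ≡⟨ ∑-cong m (λ β → ∑-cong n (λ t′ →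
                                                              trans (ℤₚ.*-identityʳ _)
                                                                (cong (λ γ → X x (combine γ t′)) (sym (quotient-combine β t))))) ⟩
    ∑ m (λ β → ∑ n (λ t′ → X x (combine (group (combine β t)) t′)))
                                                          ≡⟨ ∑-cong m (λ β → sym (·G-sum X x (combine β t))) ⟩
    ∑ m (λ β → (X · G) x (combine β t))                   ∎
    where open ≡-Reasoning

-- Kinds of pairs of fibres

data Kind : Set where
  diagonal offDiagonal : Kind

Related : ∀ {p} → Kind → Fin p → Fin p → Set
Related diagonal    U V = U ≡ V
Related offDiagonal U V = U ≢ V

related? : ∀ {p} κ (U V : Fin p) → Dec (Related κ U V)
related? diagonal    U V = U ≟ V
related? offDiagonal U V = ¬? (U ≟ V)

related-transfer : ∀ {p} κ {U V U′ V′ : Fin p} → U ≢ V → U′ ≢ V′ → Related κ U V → Related κ U′ V′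
related-transfer diagonal    U≢V _     U≡V = ⊥-elim (U≢V U≡V)
related-transfer offDiagonal _   U′≢V′ _   = U′≢V′

related-sym : ∀ {p} κ {U V : Fin p} → Related κ U V → Related κ V U
related-sym diagonal    U≡V = sym U≡V
related-sym offDiagonal U≢V = U≢V ∘ sym

mask : ∀ {p} → Kind → Fin p → Fin p → ℤ
mask {p} diagonal    U V = I p U V
mask {p} offDiagonal U V = + 1 - I p U V

mask-related : ∀ {p} κ {U V : Fin p} → Related κ U V → mask κ U V ≡ + 1
mask-related diagonal    U≡V = I-≡ U≡V
mask-related offDiagonal U≢V = cong (_-_ (+ 1)) (I-≢ U≢V)

mask-unrelated : ∀ {p} κ {U V : Fin p} → ¬ Related κ U V → mask κ U V ≡ + 0
mask-unrelated diagonal    U≢V = I-≢ U≢V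
mask-unrelated {p} offDiagonal {U} {V} ¬U≢V with U ≟ V
... | yes _   = refl
... | no  U≢V = ⊥-elim (¬U≢V U≢V)

middleSum : ℕ → Kind → Kind → ℤ → ℤ
middleSum p diagonal    diagonal    δ = δ
middleSum p diagonal    offDiagonal δ = + 1 - δ
middleSum p offDiagonal diagonal    δ = + 1 - δ
middleSum p offDiagonal offDiagonal δ = (+ p - + 1) - (+ 1 - δ)

∑-mask-mask : ∀ p κ₁ κ₂ (U W : Fin p) → ∑ p (λ V → mask κ₁ U V * mask κ₂ V W) ≡ middleSum p κ₁ κ₂ (I p U W)
∑-mask-mask p diagonal    diagonal    U W = ∑-δˡ p U (λ V → I p V W)
∑-mask-mask p diagonal    offDiagonal U W = ∑-δˡ p U (λ V → + 1 - I p V W)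
∑-mask-mask p offDiagonal diagonal    U W = trans (∑-δᶜ p U (λ V → I p V W)) (cong (_- I p U W) (∑-column-I p W))
∑-mask-mask p offDiagonal offDiagonal U W =
  trans (∑-δᶜ p U (λ V → + 1 - I p V W)) (cong (_- (+ 1 - I p U W)) (∑-column-Iᶜ p W))

fibreCount : ℕ → Kind → Kind → Kind → ℕ
fibreCount p diagonal    diagonal    diagonal    = 1
fibreCount p diagonal    diagonal    offDiagonal = 0
fibreCount p diagonal    offDiagonal diagonal    = 0
fibreCount p diagonal    offDiagonal offDiagonal = 1
fibreCount p offDiagonal diagonal    diagonal    = 0
fibreCount p offDiagonal diagonal    offDiagonal = 1
fibreCount p offDiagonal offDiagonal diagonal    = p ∸ 1
fibreCount p offDiagonal offDiagonal offDiagonal = p ∸ 2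

+-∸ : ∀ {p q} → q ≤ p → + p - + q ≡ + (p ∸ q)
+-∸ {p} {q} q≤p = trans (ℤₚ.m-n≡m⊖n p q) (ℤₚ.⊖-≥ q≤p)

∑-masks : ∀ {p} → 2 ≤ p → ∀ κ₁ κ₂ κ {U W : Fin p} → Related κ U W →
          ∑ p (λ V → mask κ₁ U V * mask κ₂ V W) ≡ + fibreCount p κ₁ κ₂ κ
∑-masks {p} 2≤p κ₁ κ₂ κ {U} {W} UW = trans (∑-mask-mask p κ₁ κ₂ U W) (count κ₁ κ₂ κ UW)
  where
  count : ∀ κ₁ κ₂ κ → Related κ U W → middleSum p κ₁ κ₂ (I p U W) ≡ + fibreCount p κ₁ κ₂ κ
  count κ₁ κ₂ diagonal U≡W rewrite I-≡ {p} U≡W with κ₁ | κ₂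
  ... | diagonal    | diagonal    = refl
  ... | diagonal    | offDiagonal = refl
  ... | offDiagonal | diagonal    = refl
  ... | offDiagonal | offDiagonal = trans (ℤₚ.+-identityʳ (+ p - + 1)) (+-∸ (ℕₚ.≤-trans (s≤s z≤n) 2≤p))
  count κ₁ κ₂ offDiagonal U≢W rewrite I-≢ {p} U≢W with κ₁ | κ₂
  ... | diagonal    | diagonal    = refl
  ... | diagonal    | offDiagonal = refl
  ... | offDiagonal | diagonal    = refl
  ... | offDiagonal | offDiagonal = trans (ℤₚ.+-assoc (+ p) (- + 1) (- (+ 1 - + 0))) (+-∸ 2≤p)

kind : Fin 5 → Kind
kind 0F = diagonal
kind 1F = diagonal
kind 2F = offDiagonal
kind 3F = offDiagonal
kind 4F = diagonal

data Generator : Set where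
  𝐎 𝐈 𝐆 𝐉 𝐀 : Generator

plus minus : Fin 5 → Generator
plus 0F = 𝐈
plus 1F = 𝐆
plus 2F = 𝐀
plus 3F = 𝐉
plus 4F = 𝐉
minus 0F = 𝐎
minus 1F = 𝐈
minus 2F = 𝐎
minus 3F = 𝐀
minus 4F = 𝐆

Compatible : ∀ {p} → Generator → Fin p → Fin p → Set
Compatible 𝐎 U V = ⊤
Compatible 𝐈 U V = U ≡ V
Compatible 𝐆 U V = U ≡ V
Compatible 𝐉 U V = ⊤
Compatible 𝐀 U V = U ≢ V

plus-compatible : ∀ {p} i {U V : Fin p} → Related (kind i) U V → Compatible (plus i) U V
plus-compatible 0F UV = UV
plus-compatible 1F UV = UV
plus-compatible 2F UV = UV
plus-compatible 3F _  = tt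
plus-compatible 4F _  = tt

minus-compatible : ∀ {p} i {U V : Fin p} → Related (kind i) U V → Compatible (minus i) U V
minus-compatible 0F _  = tt
minus-compatible 1F UV = UV
minus-compatible 2F _  = tt
minus-compatible 3F UV = UV
minus-compatible 4F UV = UV

coords : Generator → Fin 5 → ℤ
coords 𝐎 = λ _ → + 0
coords 𝐈 = + 1 ∷ + 0 ∷ + 0 ∷ + 0 ∷ + 0 ∷ []
coords 𝐆 = + 1 ∷ + 1 ∷ + 0 ∷ + 0 ∷ + 0 ∷ []
coords 𝐉 = λ _ → + 1
coords 𝐀 = + 0 ∷ + 0 ∷ + 1 ∷ + 0 ∷ + 0 ∷ []

infixr 7 _∙_
_∙_ : ℤ → (Fin 5 → ℤ) → Fin 5 → ℤ
(s ∙ c) k = s * c k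

module LinkedBlockScheme
  (f m n k λ₁ λ₂ : ℕ) (σ τ q : ℤ)
  (A : Fin f → Fin f → Mat (m ℕ.* n) (m ℕ.* n))
  (A-bits : ∀ U V → U ≢ V → ZeroOne (A U V))
  (A-transpose : ∀ U V → U ≢ V → A V U ≐ A U V ᵀ)
  (A-Gram : ∀ U V → U ≢ V → A U V · A V U ≐ GroupDivisible.Gram m n k λ₁ λ₂)
  (A-linked : ∀ U V W → U ≢ V → V ≢ W → U ≢ W →
              A U V · A V W ≐ (σ ⊙ A U W) ⊕ (τ ⊙ (J (m ℕ.* n) (m ℕ.* n) ⊖ A U W)))
  (G·A : ∀ U V → U ≢ V → GroupDivisible.G m n · A U V ≐ q ⊙ J (m ℕ.* n) (m ℕ.* n))
  (A·G : ∀ U V → U ≢ V → A U V · GroupDivisible.G m n ≐ q ⊙ J (m ℕ.* n) (m ℕ.* n))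
  (m*q≡k : + m * q ≡ + k)
  where

  open Construction f m n A
  open GroupDivisible m n

  -- The classes in block form

  ⟦_⟧ : Generator → Fin f → Fin f → Mat v v
  ⟦ 𝐎 ⟧ U V = O v v
  ⟦ 𝐈 ⟧ U V = I v
  ⟦ 𝐆 ⟧ U V = G
  ⟦ 𝐉 ⟧ U V = J v v
  ⟦ 𝐀 ⟧ U V = A U V

  difference : Fin 5 → Fin f → Fin f → Mat v v
  difference i U V = ⟦ plus i ⟧ U V ⊖ ⟦ minus i ⟧ U V

  block : Fin 5 → Fin f → Fin f → Mat v v
  block i U V a b = mask (kind i) U V * difference i U V a b

  lincomb : (Fin 5 → ℤ) → Fin f → Fin f → Mat v v
  lincomb c U W a b = ∑ 5 (λ i → c i * block i U W a b)

  A₀-combine : ∀ U W a c → A₀ (combine U a) (combine W c) ≡ I f U W * I v a c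
  A₀-combine U W a c = I-combine f v U W a c

  A₁-combine : ∀ U W β t β′ t′ →
    A₁ (combine U (combine β t)) (combine W (combine β′ t′)) ≡ I f U W * (I m β β′ * (+ 1 - I n t t′))
  A₁-combine U W β t β′ t′ = begin
    A₁ (combine U (combine β t)) (combine W (combine β′ t′))
      ≡⟨ cong₂ M (cast-assoc-combine f m n U β t) (cast-assoc-combine f m n W β′ t′) ⟩
    M (combine (combine U β) t) (combine (combine W β′) t′)
      ≡⟨ ⊗-combine (I (f ℕ.* m)) (J n n ⊖ I n) (combine U β) t (combine W β′) t′ ⟩
    I (f ℕ.* m) (combine U β) (combine W β′) * (+ 1 - I n t t′)
      ≡⟨ cong (_* (+ 1 - I n t t′)) (I-combine f m U W β β′) ⟩
    I f U W * I m β β′ * (+ 1 - I n t t′)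
      ≡⟨ ℤₚ.*-assoc (I f U W) (I m β β′) (+ 1 - I n t t′) ⟩
    I f U W * (I m β β′ * (+ 1 - I n t t′)) ∎
    where
    open ≡-Reasoning
    M : Mat ((f ℕ.* m) ℕ.* n) ((f ℕ.* m) ℕ.* n)
    M = I (f ℕ.* m) ⊗ (J n n ⊖ I n)

  A₂-combine : ∀ U W a c → A₂ (combine U a) (combine W c) ≡ (+ 1 - I f U W) * A U W a c
  A₂-combine U W a c = trans
    (cong₂ (λ x y → if ⌊ proj₁ x ≟ proj₁ y ⌋ then + 0 else A (proj₁ x) (proj₁ y) (proj₂ x) (proj₂ y))
           (Finₚ.remQuot-combine U a) (Finₚ.remQuot-combine W c))
    (if-≟-else U W (A U W a c))

  A₃-combine : ∀ U W a c → A₃ (combine U a) (combine W c) ≡ (+ 1 - I f U W) * (+ 1 - A U W a c)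
  A₃-combine U W a c = trans (cong₂ _-_ (⊗-combine (J f f ⊖ I f) (J v v) U a W c) (A₂-combine U W a c))
                             (factor (I f U W) (A U W a c))
    where
    factor : ∀ δ x → (+ 1 - δ) * + 1 - (+ 1 - δ) * x ≡ (+ 1 - δ) * (+ 1 - x)
    factor = solve-∀

  A₄-combine : ∀ U W β t β′ t′ →
    A₄ (combine U (combine β t)) (combine W (combine β′ t′)) ≡ I f U W * (+ 1 - I m β β′)
  A₄-combine U W β t β′ t′ = begin
    A₄ (combine U (combine β t)) (combine W (combine β′ t′))
      ≡⟨ cong₂ _-_ (⊗-combine (I f) (J v v) U (combine β t) W (combine β′ t′))
                   (cong₂ M (cast-assoc-combine f m n U β t) (cast-assoc-combine f m n W β′ t′)) ⟩
    I f U W * + 1 - M (combine (combine U β) t) (combine (combine W β′) t′)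
      ≡⟨ cong (_-_ (I f U W * + 1)) (⊗-combine (I (f ℕ.* m)) (J n n) (combine U β) t (combine W β′) t′) ⟩
    I f U W * + 1 - I (f ℕ.* m) (combine U β) (combine W β′) * + 1
      ≡⟨ cong (λ z → I f U W * + 1 - z * + 1) (I-combine f m U W β β′) ⟩
    I f U W * + 1 - I f U W * I m β β′ * + 1
      ≡⟨ factor (I f U W) (I m β β′) ⟩
    I f U W * (+ 1 - I m β β′) ∎
    where
    open ≡-Reasoning
    M : Mat ((f ℕ.* m) ℕ.* n) ((f ℕ.* m) ℕ.* n)
    M = I (f ℕ.* m) ⊗ J n n
    factor : ∀ δ g → δ * + 1 - δ * g * + 1 ≡ δ * (+ 1 - g)
    factor = solve-∀

  scheme-block : ∀ i U W a c → scheme i (combine U a) (combine W c) ≡ block i U W a c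
  scheme-block 0F U W a c = trans (A₀-combine U W a c) (cong (I f U W *_) (sym (ℤₚ.+-identityʳ (I v a c))))
  scheme-block 1F U W = elim-combine₂ (λ a c → A₁ (combine U a) (combine W c) ≡ block 1F U W a c)
    λ β t β′ t′ → trans (A₁-combine U W β t β′ t′) (cong (I f U W *_) (sym (G-minus-I β t β′ t′)))
  scheme-block 2F U W a c = trans (A₂-combine U W a c) (cong ((+ 1 - I f U W) *_) (sym (ℤₚ.+-identityʳ (A U W a c))))
  scheme-block 3F U W a c = A₃-combine U W a c
  scheme-block 4F U W = elim-combine₂ (λ a c → A₄ (combine U a) (combine W c) ≡ block 4F U W a c)
    λ β t β′ t′ → trans (A₄-combine U W β t β′ t′) (cong (λ g → I f U W * (+ 1 - g)) (sym (G-combine β t β′ t′)))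

  scheme-block-at : ∀ i x y → scheme i x y ≡ block i (quotient v x) (quotient v y) (remainder {f} v x) (remainder {f} v y)
  scheme-block-at i x y =
    trans (cong₂ (scheme i) (sym (Finₚ.combine-remQuot {f} v x)) (sym (Finₚ.combine-remQuot {f} v y))) (scheme-block i _ _ _ _)

  block-related : ∀ i {U V} → Related (kind i) U V → block i U V ≐ difference i U V
  block-related i {U} {V} UV a b =
    trans (cong (_* difference i U V a b) (mask-related (kind i) UV)) (ℤₚ.*-identityˡ (difference i U V a b))

  block-unrelated : ∀ i {U V} → ¬ Related (kind i) U V → block i U V ≐ O v v
  block-unrelated i {U} {V} ¬UV a b =
    trans (cong (_* difference i U V a b) (mask-unrelated (kind i) ¬UV)) (ℤₚ.*-zeroˡ (difference i U V a b))

  unfolded : ℤ → (Fin 5 → ℤ) → ℤ → ℤ → ℤ → ℤ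
  unfolded δ c i g x = c 0F * (δ * (i - + 0)) + (c 1F * (δ * (g - i)) + (c 2F * ((+ 1 - δ) * (x - + 0))
                         + (c 3F * ((+ 1 - δ) * (+ 1 - x)) + (c 4F * (δ * (+ 1 - g)) + + 0))))

  lincomb-unfolded : ∀ c U W a b → lincomb c U W a b ≡ unfolded (I f U W) c (I v a b) (G a b) (A U W a b)
  lincomb-unfolded c U W a b = refl

  lincomb-diagonal : ∀ c U a b →
    lincomb c U U a b ≡ c 0F * I v a b + c 1F * (G a b - I v a b) + c 4F * (+ 1 - G a b)
  lincomb-diagonal c U a b = begin
    lincomb c U U a b                                       ≡⟨ lincomb-unfolded c U U a b ⟩
    unfolded (I f U U) c (I v a b) (G a b) (A U U a b)      ≡⟨ cong (λ δ → unfolded δ c (I v a b) (G a b) (A U U a b)) (I-≡ {f} {U} refl) ⟩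
    unfolded (+ 1) c (I v a b) (G a b) (A U U a b)          ≡⟨ collapse (c 0F) (c 1F) (c 2F) (c 3F) (c 4F) (I v a b) (G a b) (A U U a b) ⟩
    c 0F * I v a b + c 1F * (G a b - I v a b) + c 4F * (+ 1 - G a b) ∎
    where
    open ≡-Reasoning
    collapse : ∀ c₀ c₁ c₂ c₃ c₄ i g x →
      c₀ * (+ 1 * (i - + 0)) + (c₁ * (+ 1 * (g - i)) + (c₂ * ((+ 1 - + 1) * (x - + 0))
        + (c₃ * ((+ 1 - + 1) * (+ 1 - x)) + (c₄ * (+ 1 * (+ 1 - g)) + + 0))))
      ≡ c₀ * i + c₁ * (g - i) + c₄ * (+ 1 - g)
    collapse = solve-∀

  lincomb-offDiagonal : ∀ c {U W} → U ≢ W → ∀ a b →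
    lincomb c U W a b ≡ c 2F * A U W a b + c 3F * (+ 1 - A U W a b)
  lincomb-offDiagonal c {U} {W} U≢W a b = begin
    lincomb c U W a b                                       ≡⟨ lincomb-unfolded c U W a b ⟩
    unfolded (I f U W) c (I v a b) (G a b) (A U W a b)      ≡⟨ cong (λ δ → unfolded δ c (I v a b) (G a b) (A U W a b)) (I-≢ {f} U≢W) ⟩
    unfolded (+ 0) c (I v a b) (G a b) (A U W a b)          ≡⟨ collapse (c 0F) (c 1F) (c 2F) (c 3F) (c 4F) (I v a b) (G a b) (A U W a b) ⟩
    c 2F * A U W a b + c 3F * (+ 1 - A U W a b)              ∎
    where
    open ≡-Reasoning
    collapse : ∀ c₀ c₁ c₂ c₃ c₄ i g x →
      c₀ * (+ 0 * (i - + 0)) + (c₁ * (+ 0 * (g - i)) + (c₂ * ((+ 1 - + 0) * (x - + 0))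
        + (c₃ * ((+ 1 - + 0) * (+ 1 - x)) + (c₄ * (+ 0 * (+ 1 - g)) + + 0))))
      ≡ c₂ * x + c₃ * (+ 1 - x)
    collapse = solve-∀

  lincomb-scale : ∀ s c U W a b → s * lincomb c U W a b ≡ lincomb (s ∙ c) U W a b
  lincomb-scale s c U W a b =
    trans (sym (∑-*ˡ 5 s (λ i → c i * block i U W a b))) (∑-cong 5 (λ i → sym (ℤₚ.*-assoc s (c i) (block i U W a b))))

  lincomb-minus : ∀ c d U W a b → lincomb c U W a b - lincomb d U W a b ≡ lincomb (λ i → c i - d i) U W a b
  lincomb-minus c d U W a b =
    trans (sym (∑-minus 5 (λ i → c i * block i U W a b) (λ i → d i * block i U W a b))) (∑-cong 5 (λ i → sym (distrib (c i) (d i) (block i U W a b))))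
    where
    distrib : ∀ x y z → (x - y) * z ≡ x * z - y * z
    distrib = solve-∀

  lincomb-zero : ∀ U W a b → lincomb (coords 𝐎) U W a b ≡ + 0
  lincomb-zero U W a b = trans (∑-cong 5 (λ i → ℤₚ.*-zeroˡ (block i U W a b))) (∑-zero 5)

  lincomb-cong-related : ∀ {c d U W} → (∀ l → Related (kind l) U W → c l ≡ d l) → lincomb c U W ≐ lincomb d U W
  lincomb-cong-related {c} {d} {U} {W} c≈d a b = ∑-cong 5 term
    where
    term : ∀ l → c l * block l U W a b ≡ d l * block l U W a b
    term l with related? (kind l) U W
    ... | yes UW = cong (_* block l U W a b) (c≈d l UW)
    ... | no ¬UW = trans (cong (c l *_) (block-unrelated l ¬UW a b))
                         (trans (ℤₚ.*-zeroʳ (c l)) (sym (trans (cong (d l *_) (block-unrelated l ¬UW a b)) (ℤₚ.*-zeroʳ (d l)))))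

  lincomb-basis : ∀ l U W a b → lincomb (I 5 l) U W a b ≡ block l U W a b
  lincomb-basis l U W a b = ∑-δˡ 5 l (λ i → block i U W a b)

  -- The block algebra

  m-copies-of-q : ∑ m (λ _ → q * + 1) ≡ + k * + 1
  m-copies-of-q = begin
    ∑ m (λ _ → q * + 1)   ≡⟨ ∑-const m (q * + 1) ⟩
    + m * (q * + 1)       ≡⟨ ℤₚ.*-assoc (+ m) q (+ 1) ⟨
    + m * q * + 1         ≡⟨ cong (_* + 1) m*q≡k ⟩
    + k * + 1             ∎
    where open ≡-Reasoning

  J·A : ∀ U V → U ≢ V → J v v · A U V ≐ + k ⊙ J v v
  J·A U V U≢V a c = begin
    (J v v · A U V) a c                                  ≡⟨ J·-via-G (A U V) (remainder {m} n a) a c ⟩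
    ∑ m (λ β → (G · A U V) (combine β (remainder {m} n a)) c) ≡⟨ ∑-cong m (λ β → G·A U V U≢V _ c) ⟩
    ∑ m (λ _ → q * + 1)                                  ≡⟨ m-copies-of-q ⟩
    + k * + 1                                            ∎
    where open ≡-Reasoning

  A·J : ∀ U V → U ≢ V → A U V · J v v ≐ + k ⊙ J v v
  A·J U V U≢V a c = begin
    (A U V · J v v) a c                                  ≡⟨ ·J-via-G (A U V) (remainder {m} n c) a c ⟩
    ∑ m (λ β → (A U V · G) a (combine β (remainder {m} n c))) ≡⟨ ∑-cong m (λ β → A·G U V U≢V a _) ⟩
    ∑ m (λ _ → q * + 1)                                  ≡⟨ m-copies-of-q ⟩
    + k * + 1                                            ∎
    where open ≡-Reasoning

  generator-coords : ∀ g {U W} → Compatible g U W → ⟦ g ⟧ U W ≐ lincomb (coords g) U W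
  generator-coords 𝐎 {U} {W} _ a b = sym (lincomb-zero U W a b)
  generator-coords 𝐈 {U} refl a b = sym (trans (lincomb-diagonal (coords 𝐈) U a b) (collapse (I v a b) (G a b)))
    where
    collapse : ∀ i g → + 1 * i + + 0 * (g - i) + + 0 * (+ 1 - g) ≡ i
    collapse = solve-∀
  generator-coords 𝐆 {U} refl a b = sym (trans (lincomb-diagonal (coords 𝐆) U a b) (collapse (I v a b) (G a b)))
    where
    collapse : ∀ i g → + 1 * i + + 1 * (g - i) + + 0 * (+ 1 - g) ≡ g
    collapse = solve-∀
  generator-coords 𝐉 {U} {W} _ a b = by-cases (U ≟ W)
    where
    by-cases : Dec (U ≡ W) → + 1 ≡ lincomb (coords 𝐉) U W a b
    by-cases (yes refl) = sym (trans (lincomb-diagonal (coords 𝐉) U a b) (collapse (I v a b) (G a b)))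
      where
      collapse : ∀ i g → + 1 * i + + 1 * (g - i) + + 1 * (+ 1 - g) ≡ + 1
      collapse = solve-∀
    by-cases (no U≢W) = sym (trans (lincomb-offDiagonal (coords 𝐉) U≢W a b) (collapse (A U W a b)))
      where
      collapse : ∀ x → + 1 * x + + 1 * (+ 1 - x) ≡ + 1
      collapse = solve-∀
  generator-coords 𝐀 {U} {W} U≢W a b = sym (trans (lincomb-offDiagonal (coords 𝐀) U≢W a b) (collapse (A U W a b)))
    where
    collapse : ∀ x → + 1 * x + + 0 * (+ 1 - x) ≡ x
    collapse = solve-∀

  productCoords : Generator → Generator → Fin 5 → ℤ
  productCoords 𝐎 h = coords 𝐎
  productCoords 𝐈 h = coords h
  productCoords 𝐆 𝐎 = coords 𝐎
  productCoords 𝐆 𝐈 = coords 𝐆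
  productCoords 𝐆 𝐆 = + n ∙ coords 𝐆
  productCoords 𝐆 𝐉 = + n ∙ coords 𝐉
  productCoords 𝐆 𝐀 = q ∙ coords 𝐉
  productCoords 𝐉 𝐎 = coords 𝐎
  productCoords 𝐉 𝐈 = coords 𝐉
  productCoords 𝐉 𝐆 = + n ∙ coords 𝐉
  productCoords 𝐉 𝐉 = + v ∙ coords 𝐉
  productCoords 𝐉 𝐀 = + k ∙ coords 𝐉
  productCoords 𝐀 𝐎 = coords 𝐎
  productCoords 𝐀 𝐈 = coords 𝐀
  productCoords 𝐀 𝐆 = q ∙ coords 𝐉
  productCoords 𝐀 𝐉 = + k ∙ coords 𝐉
  -- A_UV A_VW is the Gram matrix (classes 0, 1, 4) if U = W and σA + τ(J − A) (classes 2, 3)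
  -- otherwise; one coordinate vector serves both, as a block only sees classes of its kind.
  productCoords 𝐀 𝐀 = + k ∷ + λ₁ ∷ σ ∷ τ ∷ + λ₂ ∷ []

  scaled-generator : ∀ {X : Mat v v} s r U W → Compatible r U W →
                     X ≐ s ⊙ ⟦ r ⟧ U W → X ≐ lincomb (s ∙ coords r) U W
  scaled-generator s r U W r-UW X≐s⊙r a b =
    trans (X≐s⊙r a b) (trans (cong (s *_) (generator-coords r r-UW a b)) (lincomb-scale s (coords r) U W a b))

  generator-product : ∀ g h {U V W} → Compatible g U V → Compatible h V W →
                      ⟦ g ⟧ U V · ⟦ h ⟧ V W ≐ lincomb (productCoords g h) U W
  generator-product 𝐎 h {U} {V} {W} _ _ a c = trans (·-zeroˡ (⟦ h ⟧ V W) a c) (sym (lincomb-zero U W a c))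
  generator-product 𝐈 h {V = V} {W} refl h-VW a c = trans (·-identityˡ (⟦ h ⟧ V W) a c) (generator-coords h h-VW a c)
  generator-product 𝐆 𝐎 {U} {W = W} _ _ a c = trans (·-zeroʳ G a c) (sym (lincomb-zero U W a c))
  generator-product 𝐉 𝐎 {U} {W = W} _ _ a c = trans (·-zeroʳ (J v v) a c) (sym (lincomb-zero U W a c))
  generator-product 𝐀 𝐎 {U} {V} {W} _ _ a c = trans (·-zeroʳ (A U V) a c) (sym (lincomb-zero U W a c))
  generator-product 𝐆 𝐈 {U} refl refl a c = trans (·-identityʳ G a c) (generator-coords 𝐆 {U} refl a c)
  generator-product 𝐉 𝐈 {U} {W = W} _ refl a c = trans (·-identityʳ (J v v) a c) (generator-coords 𝐉 {U} {W} tt a c)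
  generator-product 𝐀 𝐈 {U} {V} U≢V refl a c = trans (·-identityʳ (A U V) a c) (generator-coords 𝐀 U≢V a c)
  generator-product 𝐆 𝐆 {U} refl refl = scaled-generator (+ n) 𝐆 U U refl G·G
  generator-product 𝐆 𝐉 {U} {W = W} _ _ = scaled-generator (+ n) 𝐉 U W tt G·J
  generator-product 𝐉 𝐆 {U} {W = W} _ _ = scaled-generator (+ n) 𝐉 U W tt J·G
  generator-product 𝐉 𝐉 {U} {W = W} _ _ = scaled-generator (+ v) 𝐉 U W tt J·J
  generator-product 𝐆 𝐀 {U} {W = W} refl U≢W = scaled-generator q 𝐉 U W tt (G·A U W U≢W)
  generator-product 𝐀 𝐆 {U} {V} U≢V refl = scaled-generator q 𝐉 U V tt (A·G U V U≢V)
  generator-product 𝐉 𝐀 {U} {V} {W} _ V≢W = scaled-generator (+ k) 𝐉 U W tt (J·A V W V≢W)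
  generator-product 𝐀 𝐉 {U} {V} {W} U≢V _ = scaled-generator (+ k) 𝐉 U W tt (A·J U V U≢V)
  generator-product 𝐀 𝐀 {U} {V} {W} U≢V V≢W a c = by-cases (U ≟ W)
    where
    by-cases : Dec (U ≡ W) → (A U V · A V W) a c ≡ lincomb (productCoords 𝐀 𝐀) U W a c
    by-cases (yes refl) = trans (A-Gram U V U≢V a c) (sym (lincomb-diagonal (productCoords 𝐀 𝐀) U a c))
    by-cases (no U≢W)   = trans (A-linked U V W U≢V V≢W U≢W a c) (sym (lincomb-offDiagonal (productCoords 𝐀 𝐀) U≢W a c))

  differenceCoords : Generator → Generator → Generator → Generator → Fin 5 → ℤ
  differenceCoords g g′ h h′ l =
    (productCoords g h l - productCoords g h′ l) - (productCoords g′ h l - productCoords g′ h′ l)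

  difference-product : ∀ g g′ h h′ {U V W} → Compatible g U V → Compatible g′ U V → Compatible h V W → Compatible h′ V W →
    (⟦ g ⟧ U V ⊖ ⟦ g′ ⟧ U V) · (⟦ h ⟧ V W ⊖ ⟦ h′ ⟧ V W) ≐ lincomb (differenceCoords g g′ h h′) U W
  difference-product g g′ h h′ {U} {V} {W} g-UV g′-UV h-VW h′-VW a c = begin
    ((P ⊖ P′) · (Q ⊖ Q′)) a c
      ≡⟨ ·-distribʳ-⊖ P P′ (Q ⊖ Q′) a c ⟩
    (P · (Q ⊖ Q′)) a c - (P′ · (Q ⊖ Q′)) a c
      ≡⟨ cong₂ _-_ (·-distribˡ-⊖ P Q Q′ a c) (·-distribˡ-⊖ P′ Q Q′ a c) ⟩
    ((P · Q) a c - (P · Q′) a c) - ((P′ · Q) a c - (P′ · Q′) a c)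
      ≡⟨ cong₂ _-_ (cong₂ _-_ (generator-product g h g-UV h-VW a c) (generator-product g h′ g-UV h′-VW a c))
                   (cong₂ _-_ (generator-product g′ h g′-UV h-VW a c) (generator-product g′ h′ g′-UV h′-VW a c)) ⟩
    (L g h - L g h′) - (L g′ h - L g′ h′)
      ≡⟨ cong₂ _-_ (lincomb-minus (productCoords g h) (productCoords g h′) U W a c)
                   (lincomb-minus (productCoords g′ h) (productCoords g′ h′) U W a c) ⟩
    lincomb (λ l → productCoords g h l - productCoords g h′ l) U W a c
      - lincomb (λ l → productCoords g′ h l - productCoords g′ h′ l) U W a c
      ≡⟨ lincomb-minus (λ l → productCoords g h l - productCoords g h′ l)
                       (λ l → productCoords g′ h l - productCoords g′ h′ l) U W a c ⟩
    lincomb (differenceCoords g g′ h h′) U W a c ∎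
    where
    open ≡-Reasoning
    P P′ Q Q′ : Mat v v
    P  = ⟦ g ⟧ U V
    P′ = ⟦ g′ ⟧ U V
    Q  = ⟦ h ⟧ V W
    Q′ = ⟦ h′ ⟧ V W
    L : Generator → Generator → ℤ
    L x y = lincomb (productCoords x y) U W a c

  structure : Fin 5 → Fin 5 → Fin 5 → ℤ
  structure i j = differenceCoords (plus i) (minus i) (plus j) (minus j)

  block-product : ∀ i j {U V W} → Related (kind i) U V → Related (kind j) V W →
                  block i U V · block j V W ≐ lincomb (structure i j) U W
  block-product i j UV VW a c = trans (·-cong (block-related i UV) (block-related j VW) a c)
    (difference-product (plus i) (minus i) (plus j) (minus j)
      (plus-compatible i UV) (minus-compatible i UV) (plus-compatible j VW) (minus-compatible j VW) a c)

  difference-bit : ∀ i {U V} → Related (kind i) U V → ∀ a b → Bit (difference i U V a b)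
  difference-bit 0F _ a b = subst Bit (sym (ℤₚ.+-identityʳ (I v a b))) (I-bit a b)
  difference-bit 1F _ = elim-combine₂ (λ a b → Bit (G a b - I v a b)) λ β t β′ t′ →
    subst Bit (sym (G-minus-I β t β′ t′)) (Bit-* (I-bit β β′) (Bit-complement (I-bit t t′)))
  difference-bit 2F {U} {V} U≢V a b = subst Bit (sym (ℤₚ.+-identityʳ (A U V a b))) (A-bits U V U≢V a b)
  difference-bit 3F {U} {V} U≢V a b = Bit-complement (A-bits U V U≢V a b)
  difference-bit 4F _ a b = Bit-complement (G-bit a b)

  block-bit : ∀ i U V a b → Bit (block i U V a b)
  block-bit i U V a b with related? (kind i) U V
  ... | yes UV = subst Bit (sym (block-related i UV a b)) (difference-bit i UV a b)
  ... | no ¬UV = inj₁ (block-unrelated i ¬UV a b)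

  generator-sym : ∀ g {U V} → Compatible g U V → ∀ a b → ⟦ g ⟧ V U b a ≡ ⟦ g ⟧ U V a b
  generator-sym 𝐎 _ a b = refl
  generator-sym 𝐈 _ a b = I-sym b a
  generator-sym 𝐆 _ a b = trans (G-entry b a) (trans (I-sym (group b) (group a)) (sym (G-entry a b)))
  generator-sym 𝐉 _ a b = refl
  generator-sym 𝐀 {U} {V} U≢V a b = A-transpose U V U≢V b a

  block-sym : ∀ i U V a b → block i V U b a ≡ block i U V a b
  block-sym i U V a b with related? (kind i) U V
  ... | yes UV = begin
    block i V U b a        ≡⟨ block-related i (related-sym (kind i) UV) b a ⟩
    difference i V U b a   ≡⟨ cong₂ _-_ (generator-sym (plus i) (plus-compatible i UV) a b)
                                        (generator-sym (minus i) (minus-compatible i UV) a b) ⟩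
    difference i U V a b   ≡⟨ block-related i UV a b ⟨
    block i U V a b        ∎
    where open ≡-Reasoning
  ... | no ¬UV = trans (block-unrelated i (¬UV ∘ related-sym (kind i)) b a) (sym (block-unrelated i ¬UV a b))

  blocks-partition : ∀ U W a b → ∑ 5 (λ i → block i U W a b) ≡ + 1
  blocks-partition U W a b =
    trans (∑-cong 5 (λ i → sym (ℤₚ.*-identityˡ (block i U W a b)))) (sym (generator-coords 𝐉 {U} {W} tt a b))

  scheme-bits : ∀ i → ZeroOne (scheme i)
  scheme-bits i = elim-combine₂ (λ x y → Bit (scheme i x y))
    λ U a W c → subst Bit (sym (scheme-block i U W a c)) (block-bit i U W a c)

  scheme-symmetric : ∀ i → scheme i ᵀ ≐ scheme i
  scheme-symmetric i = elim-combine₂ (λ x y → scheme i y x ≡ scheme i x y)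
    λ U a W c → trans (scheme-block i W U c a) (trans (block-sym i U W a c) (sym (scheme-block i U W a c)))

  scheme-partition : ∑M 5 scheme ≐ J N N
  scheme-partition = elim-combine₂ (λ x y → ∑ 5 (λ i → scheme i x y) ≡ + 1)
    λ U a W c → trans (∑-cong 5 (λ i → scheme-block i U W a c)) (blocks-partition U W a c)

  fibres : A₀ ⊕ A₁ ⊕ A₄ ≐ I f ⊗ J v v
  fibres = elim-combine₂ (λ x y → (A₀ ⊕ A₁ ⊕ A₄) x y ≡ (I f ⊗ J v v) x y) λ U a W c → begin
    A₀ (combine U a) (combine W c) + A₁ (combine U a) (combine W c) + A₄ (combine U a) (combine W c)
      ≡⟨ cong₂ _+_ (cong₂ _+_ (scheme-block 0F U W a c) (scheme-block 1F U W a c)) (scheme-block 4F U W a c) ⟩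
    I f U W * (I v a c - + 0) + I f U W * (G a c - I v a c) + I f U W * (+ 1 - G a c)
      ≡⟨ telescope (I f U W) (I v a c) (G a c) ⟩
    I f U W * + 1
      ≡⟨ ⊗-combine (I f) (J v v) U a W c ⟨
    (I f ⊗ J v v) (combine U a) (combine W c) ∎
    where
    open ≡-Reasoning
    telescope : ∀ δ i g → δ * (i - + 0) + δ * (g - i) + δ * (+ 1 - g) ≡ δ * + 1
    telescope = solve-∀

  InI-related : ∀ i {U V} → InI {f} {v} scheme U V i → Related (kind i) U V
  InI-related i {U} {V} (x , y , refl , refl , scheme≡1) with related? (kind i) U V
  ... | yes UV = UV
  ... | no ¬UV with trans (sym scheme≡1) (trans (scheme-block-at i x y) (block-unrelated i ¬UV _ _))
  ...   | ()

  -- Restriction to fibres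

  restrict-entry : ∀ M U V x y → restrictUV {f} {v} M U V x y ≡ I f (quotient v x) U * (I f (quotient v y) V * M x y)
  restrict-entry M U V x y =
    trans (if-≟-then (quotient v x) U _) (cong (I f (quotient v x) U *_) (if-≟-then (quotient v y) V (M x y)))

  restrict-combine : ∀ l U W U′ W′ a c →
    restrictUV {f} {v} (scheme l) U W (combine U′ a) (combine W′ c) ≡ I f U′ U * (I f W′ W * block l U′ W′ a c)
  restrict-combine l U W U′ W′ a c = begin
    restrictUV {f} {v} (scheme l) U W (combine U′ a) (combine W′ c)
      ≡⟨ restrict-entry (scheme l) U W (combine U′ a) (combine W′ c) ⟩
    I f (quotient v (combine U′ a)) U * (I f (quotient v (combine W′ c)) W * scheme l (combine U′ a) (combine W′ c))
      ≡⟨ cong₂ (λ X Y → I f X U * (I f Y W * scheme l (combine U′ a) (combine W′ c)))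
               (quotient-combine U′ a) (quotient-combine W′ c) ⟩
    I f U′ U * (I f W′ W * scheme l (combine U′ a) (combine W′ c))
      ≡⟨ cong (λ z → I f U′ U * (I f W′ W * z)) (scheme-block l U′ W′ a c) ⟩
    I f U′ U * (I f W′ W * block l U′ W′ a c) ∎
    where open ≡-Reasoning

  restrict-outside : ∀ M U V x y → quotient v x ≢ U ⊎ quotient v y ≢ V → restrictUV {f} {v} M U V x y ≡ + 0
  restrict-outside M U V x y (inj₁ x∉U) =
    trans (restrict-entry M U V x y) (trans (cong (_* _) (I-≢ x∉U)) (ℤₚ.*-zeroˡ (I f (quotient v y) V * M x y)))
  restrict-outside M U V x y (inj₂ y∉V) = trans (restrict-entry M U V x y)
    (trans (cong (λ z → I f (quotient v x) U * (z * M x y)) (I-≢ y∉V)) (annihilate (I f (quotient v x) U) (M x y)))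
    where
    annihilate : ∀ d z → d * (+ 0 * z) ≡ + 0
    annihilate = solve-∀

  restrict-inside : ∀ l U W a c → restrictUV {f} {v} (scheme l) U W (combine U a) (combine W c) ≡ block l U W a c
  restrict-inside l U W a c = trans (restrict-combine l U W U W a c)
    (trans (cong₂ (λ x y → x * (y * block l U W a c)) (I-≡ {f} {U} refl) (I-≡ {f} {W} refl))
           (trans (ℤₚ.*-identityˡ _) (ℤₚ.*-identityˡ _)))

  restricted-product-outside : ∀ i j U V W x y → quotient v x ≢ U ⊎ quotient v y ≢ W →
    (restrictUV {f} {v} (scheme i) U V · restrictUV {f} {v} (scheme j) V W) x y ≡ + 0
  restricted-product-outside i j U V W x y (inj₁ x∉U) = ∑-vanishing N _ λ z →
    trans (cong (_* restrictUV {f} {v} (scheme j) V W z y) (restrict-outside (scheme i) U V x z (inj₁ x∉U)))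
          (ℤₚ.*-zeroˡ (restrictUV {f} {v} (scheme j) V W z y))
  restricted-product-outside i j U V W x y (inj₂ y∉W) = ∑-vanishing N _ λ z →
    trans (cong (restrictUV {f} {v} (scheme i) U V x z *_) (restrict-outside (scheme j) V W z y (inj₂ y∉W)))
          (ℤₚ.*-zeroʳ (restrictUV {f} {v} (scheme i) U V x z))

  restricted-product-inside : ∀ i j U V W a c →
    (restrictUV {f} {v} (scheme i) U V · restrictUV {f} {v} (scheme j) V W) (combine U a) (combine W c)
      ≡ (block i U V · block j V W) a c
  restricted-product-inside i j U V W a c = begin
    (Rᵢ · Rⱼ) (combine U a) (combine W c)
      ≡⟨ ∑-combine f v _ ⟩
    ∑ f (λ V′ → ∑ v (λ b → Rᵢ (combine U a) (combine V′ b) * Rⱼ (combine V′ b) (combine W c)))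
      ≡⟨ ∑-cong f (λ V′ → ∑-cong v (term V′)) ⟩
    ∑ f (λ V′ → ∑ v (λ b → block i U V′ a b * block j V′ W b c * I f V′ V))
      ≡⟨ ∑-cong f (λ V′ → ∑-*ʳ v (I f V′ V) (λ b → block i U V′ a b * block j V′ W b c)) ⟩
    ∑ f (λ V′ → (block i U V′ · block j V′ W) a c * I f V′ V)
      ≡⟨ ∑-δʳ f V (λ V′ → (block i U V′ · block j V′ W) a c) ⟩
    (block i U V · block j V W) a c ∎
    where
    open ≡-Reasoning
    Rᵢ Rⱼ : Mat N N
    Rᵢ = restrictUV {f} {v} (scheme i) U V
    Rⱼ = restrictUV {f} {v} (scheme j) V W
    sieve : ∀ {d} → Bit d → ∀ x y → (+ 1 * (d * x)) * (d * (+ 1 * y)) ≡ x * y * d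
    sieve (inj₁ refl) = solve-∀
    sieve (inj₂ refl) = solve-∀
    term : ∀ V′ b → Rᵢ (combine U a) (combine V′ b) * Rⱼ (combine V′ b) (combine W c)
                    ≡ block i U V′ a b * block j V′ W b c * I f V′ V
    term V′ b = begin
      Rᵢ (combine U a) (combine V′ b) * Rⱼ (combine V′ b) (combine W c)
        ≡⟨ cong₂ _*_ (restrict-combine i U V U V′ a b) (restrict-combine j V W V′ W b c) ⟩
      I f U U * (I f V′ V * block i U V′ a b) * (I f V′ V * (I f W W * block j V′ W b c))
        ≡⟨ cong₂ (λ x y → x * (I f V′ V * block i U V′ a b) * (I f V′ V * (y * block j V′ W b c)))
                 (I-≡ {f} {U} refl) (I-≡ {f} {W} refl) ⟩
      + 1 * (I f V′ V * block i U V′ a b) * (I f V′ V * (+ 1 * block j V′ W b c))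
        ≡⟨ sieve (I-bit V′ V) (block i U V′ a b) (block j V′ W b c) ⟩
      block i U V′ a b * block j V′ W b c * I f V′ V ∎

  𝓘-diagonal : ∀ l {U : Fin f} → Related (kind (𝓘 l)) U U
  𝓘-diagonal 0F = refl
  𝓘-diagonal 1F = refl
  𝓘-diagonal 2F = refl

  ∑-diagonal-classes : ∀ (h : Fin 5 → ℤ) → h 2F ≡ + 0 → h 3F ≡ + 0 → ∑ 5 h ≡ ∑ 3 (λ l → h (𝓘 l))
  ∑-diagonal-classes h h₂≡0 h₃≡0 = cong (λ z → h 0F + (h 1F + z)) (begin
    h 2F + (h 3F + (h 4F + + 0))   ≡⟨ cong₂ (λ x y → x + (y + (h 4F + + 0))) h₂≡0 h₃≡0 ⟩
    + 0 + (+ 0 + (h 4F + + 0))     ≡⟨ ℤₚ.+-identityˡ _ ⟩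
    + 0 + (h 4F + + 0)             ≡⟨ ℤₚ.+-identityˡ _ ⟩
    h 4F + + 0                     ∎)
    where open ≡-Reasoning

  restricted-block : ∀ U l a b → restricted U l a b ≡ block (𝓘 l) U U a b
  restricted-block U l = scheme-block (𝓘 l) U U

  restricted-identity : ∀ U → restricted U 0F ≐ I v
  restricted-identity U a b =
    trans (restricted-block U 0F a b) (trans (block-related 0F {U} refl a b) (ℤₚ.+-identityʳ (I v a b)))

  restricted-bits : ∀ U l → ZeroOne (restricted U l)
  restricted-bits U l a b = subst Bit (sym (restricted-block U l a b)) (block-bit (𝓘 l) U U a b)

  restricted-symmetric : ∀ U l → restricted U l ᵀ ≐ restricted U l
  restricted-symmetric U l a b =
    trans (restricted-block U l b a) (trans (block-sym (𝓘 l) U U a b) (sym (restricted-block U l a b)))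

  restricted-partition : ∀ U → ∑M 3 (restricted U) ≐ J v v
  restricted-partition U a b = begin
    ∑ 3 (λ l → restricted U l a b)                ≡⟨ ∑-cong 3 (λ l → restricted-block U l a b) ⟩
    ∑ 3 (λ l → block (𝓘 l) U U a b)               ≡⟨ ∑-diagonal-classes (λ i → block i U U a b)
                                                       (block-unrelated 2F {U} (λ U≢U → U≢U refl) a b)
                                                       (block-unrelated 3F {U} (λ U≢U → U≢U refl) a b) ⟨
    ∑ 5 (λ i → block i U U a b)                   ≡⟨ blocks-partition U U a b ⟩
    + 1                                           ∎
    where open ≡-Reasoning

  -- ∣_∣ is harmless: structure i j l is nonnegative whenever class l occurs in the product
  -- (structure-nonneg), and the block of class l vanishes otherwise.
  uniformNumber : Fin 5 → Fin 5 → Fin 5 → ℕ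
  uniformNumber i j l = ∣ structure i j l ∣

  record Witness (l : Fin 5) (U W : Fin f) : Set where
    field
      row col : Fin v
      selects : ∀ c → lincomb c U W row col ≡ c l

    block-one : block l U W row col ≡ + 1
    block-one = trans (sym (lincomb-basis l U W row col)) (trans (selects (I 5 l)) (I-≡ refl))

  selects-diagonal : ∀ {U a c} x y → I v a c ≡ x → G a c ≡ y →
                     ∀ cs → lincomb cs U U a c ≡ cs 0F * x + cs 1F * (y - x) + cs 4F * (+ 1 - y)
  selects-diagonal {U} {a} {c} x y I≡x G≡y cs =
    trans (lincomb-diagonal cs U a c) (cong₂ (λ i g → cs 0F * i + cs 1F * (g - i) + cs 4F * (+ 1 - g)) I≡x G≡y)

  selects-offDiagonal : ∀ {U W a c} → U ≢ W → ∀ x → A U W a c ≡ x →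
                        ∀ cs → lincomb cs U W a c ≡ cs 2F * x + cs 3F * (+ 1 - x)
  selects-offDiagonal {a = a} {c} U≢W x A≡x cs =
    trans (lincomb-offDiagonal cs U≢W a c) (cong (λ y → cs 2F * y + cs 3F * (+ 1 - y)) A≡x)

  row-sum : ∀ U W → U ≢ W → ∀ a → ∑ v (A U W a) ≡ + k
  row-sum U W U≢W a =
    trans (∑-cong v (λ c → sym (ℤₚ.*-identityʳ (A U W a c)))) (trans (A·J U W U≢W a a) (ℤₚ.*-identityʳ (+ k)))

  module Nondegenerate (2≤f : 2 ≤ f) (2≤m : 2 ≤ m) (2≤n : 2 ≤ n) (0<k : 0 < k) (k<v : k < v) where

    β₀ β₁ : Fin m
    β₀ = proj₁ (distinct-pair 2≤m)
    β₁ = proj₁ (proj₂ (distinct-pair 2≤m))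

    β₀≢β₁ : β₀ ≢ β₁
    β₀≢β₁ = proj₂ (proj₂ (distinct-pair 2≤m))

    t₀ t₁ : Fin n
    t₀ = proj₁ (distinct-pair 2≤n)
    t₁ = proj₁ (proj₂ (distinct-pair 2≤n))

    t₀≢t₁ : t₀ ≢ t₁
    t₀≢t₁ = proj₂ (proj₂ (distinct-pair 2≤n))

    witness : ∀ l {U W} → Related (kind l) U W → Witness l U W
    witness 0F {U} refl = record
      { row = combine β₀ t₀ ; col = combine β₀ t₀
      ; selects = λ cs → trans (selects-diagonal {U} (+ 1) (+ 1) (I-≡ refl) (trans (G-combine β₀ t₀ β₀ t₀) (I-≡ refl)) cs)
                               (collapse (cs 0F) (cs 1F) (cs 4F)) }
      where
      collapse : ∀ x y z → x * + 1 + y * (+ 1 - + 1) + z * (+ 1 - + 1) ≡ x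
      collapse = solve-∀
    witness 1F {U} refl = record
      { row = combine β₀ t₀ ; col = combine β₀ t₁
      ; selects = λ cs → trans (selects-diagonal {U} (+ 0) (+ 1)
                                  (I-≢ (t₀≢t₁ ∘ Finₚ.combine-injectiveʳ β₀ t₀ β₀ t₁))
                                  (trans (G-combine β₀ t₀ β₀ t₁) (I-≡ refl)) cs)
                               (collapse (cs 0F) (cs 1F) (cs 4F)) }
      where
      collapse : ∀ x y z → x * + 0 + y * (+ 1 - + 0) + z * (+ 1 - + 1) ≡ y
      collapse = solve-∀
    witness 4F {U} refl = record
      { row = combine β₀ t₀ ; col = combine β₁ t₀
      ; selects = λ cs → trans (selects-diagonal {U} (+ 0) (+ 0)
                                  (I-≢ (β₀≢β₁ ∘ Finₚ.combine-injectiveˡ β₀ t₀ β₁ t₀))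
                                  (trans (G-combine β₀ t₀ β₁ t₀) (I-≢ β₀≢β₁)) cs)
                               (collapse (cs 0F) (cs 1F) (cs 4F)) }
      where
      collapse : ∀ x y z → x * + 0 + y * (+ 0 - + 0) + z * (+ 1 - + 0) ≡ z
      collapse = solve-∀
    witness 2F {U} {W} U≢W with ∑-bits-nonzero v (A U W (combine β₀ t₀)) (A-bits U W U≢W (combine β₀ t₀))
                                  (λ ∑≡0 → ℕₚ.<⇒≢ 0<k (sym (ℤₚ.+-injective (trans (sym (row-sum U W U≢W _)) ∑≡0))))
    ... | c , A≡1 = record
      { row = combine β₀ t₀ ; col = c
      ; selects = λ cs → trans (selects-offDiagonal U≢W (+ 1) A≡1 cs) (collapse (cs 2F) (cs 3F)) }
      where
      collapse : ∀ x y → x * + 1 + y * (+ 1 - + 1) ≡ x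
      collapse = solve-∀
    witness 3F {U} {W} U≢W with ∑-bits-short v (A U W (combine β₀ t₀)) (A-bits U W U≢W (combine β₀ t₀))
                                  (λ ∑≡v → ℕₚ.<⇒≢ k<v (ℤₚ.+-injective (trans (sym (row-sum U W U≢W _)) ∑≡v)))
    ... | c , A≡0 = record
      { row = combine β₀ t₀ ; col = c
      ; selects = λ cs → trans (selects-offDiagonal U≢W (+ 0) A≡0 cs) (collapse (cs 2F) (cs 3F)) }
      where
      collapse : ∀ x y → x * + 0 + y * (+ 1 - + 0) ≡ y
      collapse = solve-∀

    structure-nonneg : ∀ i j l {U V W} → Related (kind i) U V → Related (kind j) V W → Related (kind l) U W →
                       structure i j l ≥ + 0
    structure-nonneg i j l {U} {V} {W} UV VW UW = subst (_≥ + 0) product≡structure product≥0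
      where
      open Witness (witness l UW)
      product≡structure : (block i U V · block j V W) row col ≡ structure i j l
      product≡structure = trans (block-product i j UV VW row col) (selects (structure i j))
      product≥0 : (block i U V · block j V W) row col ≥ + 0
      product≥0 = ∑-nonneg v _ (λ b → Bit-nonneg (Bit-* (block-bit i U V row b) (block-bit j V W b col)))

    block-product-ℕ : ∀ i j {U V W} → Related (kind i) U V → Related (kind j) V W →
                      block i U V · block j V W ≐ lincomb (λ l → + uniformNumber i j l) U W
    block-product-ℕ i j UV VW a c = trans (block-product i j UV VW a c)
      (lincomb-cong-related (λ l UW → sym (ℤₚ.0≤i⇒+∣i∣≡i (structure-nonneg i j l UV VW UW))) a c)

    block-product-masked : ∀ i j U V W a c → (block i U V · block j V W) a c
                           ≡ mask (kind i) U V * mask (kind j) V W * lincomb (λ l → + uniformNumber i j l) U W a c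
    block-product-masked i j U V W a c = by-cases (related? (kind i) U V) (related? (kind j) V W)
      where
      L : ℤ
      L = lincomb (λ l → + uniformNumber i j l) U W a c
      annihilateˡ : ∀ y z → + 0 * y * z ≡ + 0
      annihilateˡ = solve-∀
      annihilateᵐ : ∀ x z → x * + 0 * z ≡ + 0
      annihilateᵐ = solve-∀
      by-cases : Dec (Related (kind i) U V) → Dec (Related (kind j) V W) →
                 (block i U V · block j V W) a c ≡ mask (kind i) U V * mask (kind j) V W * L
      by-cases (yes UV) (yes VW) = trans (block-product-ℕ i j UV VW a c) (sym (trans
        (cong₂ (λ x y → x * y * L) (mask-related (kind i) UV) (mask-related (kind j) VW)) (ℤₚ.*-identityˡ L)))
      by-cases (no ¬UV) _ = begin
        (block i U V · block j V W) a c         ≡⟨ ·-cong {Q = block j V W} {Q′ = block j V W} (block-unrelated i ¬UV) (λ _ _ → refl) a c ⟩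
        (O v v · block j V W) a c               ≡⟨ ·-zeroˡ (block j V W) a c ⟩
        + 0                                     ≡⟨ annihilateˡ (mask (kind j) V W) L ⟨
        + 0 * mask (kind j) V W * L             ≡⟨ cong (λ x → x * mask (kind j) V W * L) (mask-unrelated (kind i) ¬UV) ⟨
        mask (kind i) U V * mask (kind j) V W * L ∎
        where open ≡-Reasoning
      by-cases (yes _) (no ¬VW) = begin
        (block i U V · block j V W) a c         ≡⟨ ·-cong {P = block i U V} {P′ = block i U V} (λ _ _ → refl) (block-unrelated j ¬VW) a c ⟩
        (block i U V · O v v) a c               ≡⟨ ·-zeroʳ (block i U V) a c ⟩
        + 0                                     ≡⟨ annihilateᵐ (mask (kind i) U V) L ⟨
        mask (kind i) U V * + 0 * L             ≡⟨ cong (λ y → mask (kind i) U V * y * L) (mask-unrelated (kind j) ¬VW) ⟨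
        mask (kind i) U V * mask (kind j) V W * L ∎
        where open ≡-Reasoning

    related-pair : ∀ κ → Σ (Fin f) λ U → Σ (Fin f) λ W → Related κ U W
    related-pair diagonal    = proj₁ (distinct-pair 2≤f) , proj₁ (distinct-pair 2≤f) , refl
    related-pair offDiagonal = distinct-pair 2≤f

    intersectionNumber : Fin 5 → Fin 5 → Fin 5 → ℕ
    intersectionNumber i j l = fibreCount f (kind i) (kind j) (kind l) ℕ.* uniformNumber i j l

    scheme-product : ∀ i j → scheme i · scheme j ≐ ∑M 5 (λ l → + intersectionNumber i j l ⊙ scheme l)
    scheme-product i j = elim-combine₂ (λ x y → (scheme i · scheme j) x y ≡ ∑ 5 (λ l → + intersectionNumber i j l * scheme l x y))
      λ U a W c → let L = lincomb (λ l → + uniformNumber i j l) U W a c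
                      count = ∑ f (λ V → mask (kind i) U V * mask (kind j) V W) in begin
        (scheme i · scheme j) (combine U a) (combine W c)
          ≡⟨ ∑-combine f v _ ⟩
        ∑ f (λ V → ∑ v (λ b → scheme i (combine U a) (combine V b) * scheme j (combine V b) (combine W c)))
          ≡⟨ ∑-cong f (λ V → ∑-cong v (λ b → cong₂ _*_ (scheme-block i U V a b) (scheme-block j V W b c))) ⟩
        ∑ f (λ V → (block i U V · block j V W) a c)
          ≡⟨ ∑-cong f (λ V → block-product-masked i j U V W a c) ⟩
        ∑ f (λ V → mask (kind i) U V * mask (kind j) V W * L)
          ≡⟨ ∑-*ʳ f L (λ V → mask (kind i) U V * mask (kind j) V W) ⟩
        ∑ f (λ V → mask (kind i) U V * mask (kind j) V W) * L
          ≡⟨ lincomb-scale count (λ l → + uniformNumber i j l) U W a c ⟩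
        lincomb (count ∙ (λ l → + uniformNumber i j l)) U W a c
          ≡⟨ lincomb-cong-related {U = U} {W}
               (λ l UW → trans (cong (_* + uniformNumber i j l) (∑-masks 2≤f (kind i) (kind j) (kind l) UW))
                               (sym (ℤₚ.pos-* (fibreCount f (kind i) (kind j) (kind l)) (uniformNumber i j l)))) a c ⟩
        lincomb (λ l → + intersectionNumber i j l) U W a c
          ≡⟨ ∑-cong 5 (λ l → cong (+ intersectionNumber i j l *_) (sym (scheme-block l U W a c))) ⟩
        ∑ 5 (λ l → + intersectionNumber i j l * scheme l (combine U a) (combine W c)) ∎
      where open ≡-Reasoning

    scheme-nonzero : ∀ i → NonZeroMat (scheme i)
    scheme-nonzero i with related-pair (kind i)
    ... | U , W , UW = combine U row , combine W col
                     , λ scheme≡0 → +1≢+0 (trans (sym block-one) (trans (sym (scheme-block i U W row col)) scheme≡0))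
      where open Witness (witness i UW)

    is-scheme : IsSymAssocScheme 4 scheme
    is-scheme = (λ _ _ → refl) , scheme-bits , scheme-symmetric , scheme-nonzero , scheme-partition
              , λ i j → intersectionNumber i j , scheme-product i j

    is-imprimitive : IsImprimitive 4 scheme
    is-imprimitive = 1F , (λ ()) , disconnected-by-blocks (scheme 1F) 2≤f (combine β₀ t₀)
      λ U a W c U≢W → trans (scheme-block 1F U W a c) (block-unrelated 1F U≢W a c)

    related-InI : ∀ i {U V} → Related (kind i) U V → InI {f} {v} scheme U V i
    related-InI i {U} {V} UV = combine U row , combine V col , quotient-combine U row , quotient-combine V col
                             , trans (scheme-block i U V row col) block-one
      where open Witness (witness i UV)

    uniform-product : ∀ i j {U V W} → Related (kind i) U V → Related (kind j) V W →
      restrictUV {f} {v} (scheme i) U V · restrictUV {f} {v} (scheme j) V W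
        ≐ ∑M 5 (λ l → + uniformNumber i j l ⊙ restrictUV {f} {v} (scheme l) U W)
    uniform-product i j {U} {V} {W} UV VW =
      elim-combine₂ Goal λ U′ a W′ c → by-cases U′ a W′ c (U′ ≟ U) (W′ ≟ W)
      where
      R : Fin 5 → Fin f → Fin f → Mat N N
      R l = restrictUV {f} {v} (scheme l)
      Goal : Fin N → Fin N → Set
      Goal x y = (R i U V · R j V W) x y ≡ ∑ 5 (λ l → + uniformNumber i j l * R l U W x y)
      outside : ∀ x y → quotient v x ≢ U ⊎ quotient v y ≢ W → Goal x y
      outside x y o = trans (restricted-product-outside i j U V W x y o) (sym (∑-vanishing 5 _ λ l →
        trans (cong (+ uniformNumber i j l *_) (restrict-outside (scheme l) U W x y o)) (ℤₚ.*-zeroʳ (+ uniformNumber i j l))))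
      by-cases : ∀ U′ a W′ c → Dec (U′ ≡ U) → Dec (W′ ≡ W) → Goal (combine U′ a) (combine W′ c)
      by-cases _ a _ c (yes refl) (yes refl) = begin
        (R i U V · R j V W) (combine U a) (combine W c)
          ≡⟨ restricted-product-inside i j U V W a c ⟩
        (block i U V · block j V W) a c
          ≡⟨ block-product-ℕ i j UV VW a c ⟩
        lincomb (λ l → + uniformNumber i j l) U W a c
          ≡⟨ ∑-cong 5 (λ l → cong (+ uniformNumber i j l *_) (restrict-inside l U W a c)) ⟨
        ∑ 5 (λ l → + uniformNumber i j l * R l U W (combine U a) (combine W c)) ∎
        where open ≡-Reasoning
      by-cases U′ a W′ c (no U′≢U) _ =
        outside (combine U′ a) (combine W′ c) (inj₁ (U′≢U ∘ trans (sym (quotient-combine U′ a))))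
      by-cases U′ a W′ c (yes _) (no W′≢W) =
        outside (combine U′ a) (combine W′ c) (inj₂ (W′≢W ∘ trans (sym (quotient-combine W′ c))))

    is-uniform : IsUniform {f} {v} 4 scheme
    is-uniform = (λ U V U′ V′ U≢V U′≢V′ i →
                    (λ in-UV → related-InI i (related-transfer (kind i) U≢V U′≢V′ (InI-related i in-UV)))
                  , (λ in-U′V′ → related-InI i (related-transfer (kind i) U′≢V′ U≢V (InI-related i in-U′V′))))
               , uniformNumber
               , (λ U V W i j in-UV in-VW → uniform-product i j (InI-related i in-UV) (InI-related j in-VW))

    restricted-nonzero : ∀ U l → NonZeroMat (restricted U l)
    restricted-nonzero U l = row , col
      , λ restricted≡0 → +1≢+0 (trans (sym block-one) (trans (sym (restricted-block U l row col)) restricted≡0))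
      where open Witness (witness (𝓘 l) {U} {U} (𝓘-diagonal l))

    restricted-product : ∀ U i j → restricted U i · restricted U j
                                   ≐ ∑M 3 (λ l → + uniformNumber (𝓘 i) (𝓘 j) (𝓘 l) ⊙ restricted U l)
    restricted-product U i j a c = begin
      (restricted U i · restricted U j) a c
        ≡⟨ ·-cong (restricted-block U i) (restricted-block U j) a c ⟩
      (block (𝓘 i) U U · block (𝓘 j) U U) a c
        ≡⟨ block-product-ℕ (𝓘 i) (𝓘 j) {U} {U} {U} (𝓘-diagonal i) (𝓘-diagonal j) a c ⟩
      lincomb (λ l → + uniformNumber (𝓘 i) (𝓘 j) l) U U a c
        ≡⟨ ∑-diagonal-classes (λ l → + uniformNumber (𝓘 i) (𝓘 j) l * block l U U a c)
             (off-diagonal-vanishes 2F (λ U≢U → U≢U refl)) (off-diagonal-vanishes 3F (λ U≢U → U≢U refl)) ⟩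
      ∑ 3 (λ l → + uniformNumber (𝓘 i) (𝓘 j) (𝓘 l) * block (𝓘 l) U U a c)
        ≡⟨ ∑-cong 3 (λ l → cong (+ uniformNumber (𝓘 i) (𝓘 j) (𝓘 l) *_) (restricted-block U l a c)) ⟨
      ∑ 3 (λ l → + uniformNumber (𝓘 i) (𝓘 j) (𝓘 l) * restricted U l a c) ∎
      where
      open ≡-Reasoning
      off-diagonal-vanishes : ∀ l → ¬ Related (kind l) U U → + uniformNumber (𝓘 i) (𝓘 j) l * block l U U a c ≡ + 0
      off-diagonal-vanishes l ¬UU =
        trans (cong (+ uniformNumber (𝓘 i) (𝓘 j) l *_) (block-unrelated l ¬UU a c)) (ℤₚ.*-zeroʳ (+ uniformNumber (𝓘 i) (𝓘 j) l))

    restricted-scheme : ∀ U → IsSymAssocScheme 2 (restricted U)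
    restricted-scheme U = restricted-identity U , restricted-bits U , restricted-symmetric U , restricted-nonzero U
                        , restricted-partition U , λ i j → (λ l → uniformNumber (𝓘 i) (𝓘 j) (𝓘 l)) , restricted-product U i j

    restricted-imprimitive : ∀ U → IsImprimitive 2 (restricted U)
    restricted-imprimitive U = 1F , (λ ()) , disconnected-by-blocks (restricted U 1F) 2≤m t₀
      λ β t β′ t′ β≢β′ → begin
        restricted U 1F (combine β t) (combine β′ t′)           ≡⟨ restricted-block U 1F (combine β t) (combine β′ t′) ⟩
        block 1F U U (combine β t) (combine β′ t′)              ≡⟨ block-related 1F {U} refl (combine β t) (combine β′ t′) ⟩
        G (combine β t) (combine β′ t′) - I v (combine β t) (combine β′ t′) ≡⟨ G-minus-I β t β′ t′ ⟩
        I m β β′ * (+ 1 - I n t t′)                             ≡⟨ cong (_* (+ 1 - I n t t′)) (I-≢ β≢β′) ⟩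
        + 0 * (+ 1 - I n t t′)                                  ≡⟨ ℤₚ.*-zeroˡ (+ 1 - I n t t′) ⟩
        + 0                                                     ∎
      where open ≡-Reasoning

-- From a linked system of designs

cancel-factor : ∀ {m} → 0 < m → ∀ {x y z : ℤ} → + m * x ≡ z → + m * y ≡ z → x ≡ y
cancel-factor {m} 0<m mx≡z my≡z = ℤₚ.*-cancelˡ-≡ (+ m) _ _ {{ℕ.>-nonZero 0<m}} (trans mx≡z (sym my≡z))

module FromLinkedSystem
  (f k m n λ₁ λ₂ : ℕ) (2≤f : 2 ≤ f) (A : Fin f → Fin f → Mat (m ℕ.* n) (m ℕ.* n))
  (linked : IsLinkedSystem f k m n λ₁ λ₂ A)
  (balanced : ∀ i j → i ≢ j →
                (+ m ⊙ (A i j · (I m ⊗ J n n)) ≐ + k ⊙ J (m ℕ.* n) (m ℕ.* n))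
              × (+ m ⊙ ((I m ⊗ J n n) · A i j) ≐ + k ⊙ J (m ℕ.* n) (m ℕ.* n)))
  where

  open GroupDivisible m n using (G)

  σ τ : ℤ
  σ = proj₁ (proj₂ (proj₂ linked))
  τ = proj₁ (proj₂ (proj₂ (proj₂ linked)))

  U₀ U₁ : Fin f
  U₀ = proj₁ (distinct-pair 2≤f)
  U₁ = proj₁ (proj₂ (distinct-pair 2≤f))

  U₀≢U₁ : U₀ ≢ U₁
  U₀≢U₁ = proj₂ (proj₂ (distinct-pair 2≤f))

  design : ∀ U V → U ≢ V → IsSGDD k m n λ₁ λ₂ (A U V)
  design = proj₁ (proj₂ linked)

  2≤m : 2 ≤ m
  2≤m = proj₁ (design U₀ U₁ U₀≢U₁)

  2≤n : 2 ≤ n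
  2≤n = proj₁ (proj₂ (design U₀ U₁ U₀≢U₁))

  0<k : 0 < k
  0<k = proj₁ (proj₂ (proj₂ (design U₀ U₁ U₀≢U₁)))

  k<v : k < m ℕ.* n
  k<v = proj₁ (proj₂ (proj₂ (proj₂ (design U₀ U₁ U₀≢U₁))))

  0<m : 0 < m
  0<m = ℕₚ.≤-trans (s≤s z≤n) 2≤m

  a₀ : Fin (m ℕ.* n)
  a₀ = combine (proj₁ (distinct-pair 2≤m)) (proj₁ (distinct-pair 2≤n))

  -- q plays the role of k/m: every entry x of G · A U V satisfies m x = k.
  q : ℤ
  q = (G · A U₀ U₁) a₀ a₀

  m*q≡k : + m * q ≡ + k
  m*q≡k = trans (proj₂ (balanced U₀ U₁ U₀≢U₁) a₀ a₀) (ℤₚ.*-identityʳ (+ k))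

  G·A : ∀ U V → U ≢ V → G · A U V ≐ q ⊙ J (m ℕ.* n) (m ℕ.* n)
  G·A U V U≢V a c = trans (cancel-factor 0<m (proj₂ (balanced U V U≢V) a c) (proj₂ (balanced U₀ U₁ U₀≢U₁) a₀ a₀))
                          (sym (ℤₚ.*-identityʳ q))

  A·G : ∀ U V → U ≢ V → A U V · G ≐ q ⊙ J (m ℕ.* n) (m ℕ.* n)
  A·G U V U≢V a c = trans (cancel-factor 0<m (proj₁ (balanced U V U≢V) a c) (proj₂ (balanced U₀ U₁ U₀≢U₁) a₀ a₀))
                          (sym (ℤₚ.*-identityʳ q))

  A-bits : ∀ U V → U ≢ V → ZeroOne (A U V)
  A-bits U V U≢V = proj₁ (proj₂ (proj₂ (proj₂ (proj₂ (design U V U≢V)))))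

  A-Gram : ∀ U V → U ≢ V → A U V · A V U ≐ GroupDivisible.Gram m n k λ₁ λ₂
  A-Gram U V U≢V a c = trans (·-cong {P = A U V} (λ _ _ → refl) (proj₁ linked U V U≢V) a c)
                             (proj₁ (proj₂ (proj₂ (proj₂ (proj₂ (proj₂ (design U V U≢V)))))) a c)

  A-linked : ∀ U V W → U ≢ V → V ≢ W → U ≢ W →
             A U V · A V W ≐ (σ ⊙ A U W) ⊕ (τ ⊙ (J (m ℕ.* n) (m ℕ.* n) ⊖ A U W))
  A-linked = proj₂ (proj₂ (proj₂ (proj₂ linked)))

  open LinkedBlockScheme f m n k λ₁ λ₂ σ τ q A A-bits (proj₁ linked) A-Gram A-linked G·A A·G m*q≡k public
  open Nondegenerate 2≤f 2≤m 2≤n 0<k k<v public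

theorem4p1 : (f k m n λ₁ λ₂ : ℕ) → 2 ≤ f
    → (A : Fin f → Fin f → Mat (m ℕ.* n) (m ℕ.* n))
    → IsLinkedSystem f k m n λ₁ λ₂ A
    → (∀ i j → i ≢ j →
         (+ m ⊙ (A i j · (I m ⊗ J n n)) ≐ + k ⊙ J (m ℕ.* n) (m ℕ.* n))
         × (+ m ⊙ ((I m ⊗ J n n) · A i j) ≐ + k ⊙ J (m ℕ.* n) (m ℕ.* n)))
    → let open Construction f m n A in
      IsSymAssocScheme 4 scheme
      × IsImprimitive 4 scheme
      × (A₀ ⊕ A₁ ⊕ A₄ ≐ I f ⊗ J (m ℕ.* n) (m ℕ.* n))
      × IsUniform {f} {m ℕ.* n} 4 scheme
      × (∀ U → IsSymAssocScheme 2 (restricted U) × IsImprimitive 2 (restricted U))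
theorem4p1 f k m n λ₁ λ₂ 2≤f A linked balanced =
  is-scheme , is-imprimitive , fibres , is-uniform , λ U → restricted-scheme U , restricted-imprimitive U
  where open FromLinkedSystem f k m n λ₁ λ₂ 2≤f A linked balanced
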